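{- As formal power series in $q$, \[ \sum_{n\geq 1} \frac{2q^n}{1+q^n}\, \frac{(-q;q)_{n-1}}{(q;q)_{n-1}} \;=\; \sum_{n\geq 0} \frac{q^{n(n+1)/2}}{(q;q)_n}\,\frac{2q^{n+1}}{1-q^{2(n+1)}}\, \frac{(-q^{n+2};q)_\infty}{(q^{n+2};q)_\infty}. \]
   Context: For a non-negative integer $L$, $(a;q)_L=\prod_{i=0}^{L-1}(1-aq^i)$ (so $(a;q)_0=1$), and $(a;q)_\infty=\lim_{L\to\infty}(a;q)_L$. -}

module Defs where

open import Data.Nat using (ℕ; zero; suc; _≤_; _∸_; _≡ᵇ_)
import Data.Nat as ℕ
open import Data.Integer using (ℤ; +_; -_; _+_; _*_; _-_; 0ℤ; 1ℤ)
open import Data.Bool using (if_then_else_)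
open import Data.Product using (∃)
open import Relation.Binary.PropositionalEquality using (_≡_)

-- Formal power series in q with integer coefficients: N ↦ coefficient of q^N.
PS : Set
PS = ℕ → ℤ

sumℤ : ℕ → (ℕ → ℤ) → ℤ
sumℤ zero    f = 0ℤ
sumℤ (suc n) f = sumℤ n f + f n

mono : ℤ → ℕ → PS
mono c k N = if N ≡ᵇ k then c else 0ℤ

one : PS
one = mono 1ℤ 0

infixl 6 _⊕_ _⊖_
infixl 7 _⊛_

_⊕_ : PS → PS → PS
(f ⊕ g) N = f N + g N

_⊖_ : PS → PS → PS
(f ⊖ g) N = f N - g N

_⊛_ : PS → PS → PS
(f ⊛ g) N = sumℤ (suc N) (λ k → f k * g (N ∸ k))

pow : PS → ℕ → PS
pow f zero    = one
pow f (suc k) = pow f k ⊛ f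

-- Multiplicative inverse of a series f with constant term 1:
-- 1/f = Σ_{k ≥ 0} (1 - f)^k ; since 1 - f has no constant term,
-- the coefficient of q^N only receives contributions from k ≤ N.
inv : PS → PS
inv f N = sumℤ (suc N) (λ k → pow (one ⊖ f) k N)

prodPS : ℕ → (ℕ → PS) → PS
prodPS zero    F = one
prodPS (suc L) F = prodPS L F ⊛ F L

sumPS : ℕ → (ℕ → PS) → PS
sumPS L F N = sumℤ L (λ i → F i N)

poch : PS → ℕ → PS
poch a L = prodPS L (λ i → one ⊖ a ⊛ mono 1ℤ i)

Converges : (ℕ → PS) → PS → Set
Converges S T = ∀ N → ∃ λ M₀ → ∀ M → M₀ ≤ M → S M N ≡ T N

qpow : ℕ → PS
qpow m = mono 1ℤ m

negqpow : ℕ → PS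
negqpow m = mono (- 1ℤ) m

lhsTerm : ℕ → PS
lhsTerm n = mono (+ 2) n ⊛ inv (one ⊕ qpow n)
            ⊛ poch (negqpow 1) (n ∸ 1) ⊛ inv (poch (qpow 1) (n ∸ 1))

lhsPartial : ℕ → PS
lhsPartial M = sumPS M (λ i → lhsTerm (suc i))

-- RHS summand, n ≥ 0, given P n = (-q^{n+2};q)_∞ and Q n = (q^{n+2};q)_∞:
-- q^{n(n+1)/2}/(q;q)_n · 2q^{n+1}/(1-q^{2(n+1)}) · P n / Q n
rhsTerm : (ℕ → PS) → (ℕ → PS) → ℕ → PS
rhsTerm P Q n = qpow ((n ℕ.* suc n) ℕ./ 2) ⊛ inv (poch (qpow 1) n)
                ⊛ (mono (+ 2) (suc n) ⊛ inv (one ⊖ qpow (2 ℕ.* suc n)))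
                ⊛ P n ⊛ inv (Q n)

rhsPartial : (ℕ → PS) → (ℕ → PS) → ℕ → PS
rhsPartial P Q M = sumPS M (rhsTerm P Q)

-- Write (a)_n for (a;q)_n and ρ for (-q;q)_∞/(q;q)_∞.  For F(z) = Σ_j (-q)_j/(q)_j z^j the
-- q-binomial functional equation (1 - z) F(z) = (1 + qz) F(qz) gives
-- F(q^{k+1}) = ρ (q)_k/(-q)_{k+1}.  Expanding 2q^n/(1+q^n) geometrically and summing over n
-- first therefore turns the left side into 2ρ Σ_k (-1)^k q^{k+1} (q)_k/(-q)_{k+1}.  On the
-- right, the quotient of infinite products is ρ (q)_{n+1}/(-q)_{n+1} and
-- 1 - q^{2n+2} = (1 - q^{n+1})(1 + q^{n+1}), so the right side is
-- 2ρ Σ_n q^{(n+1)(n+2)/2}/((-q)_{n+1} (1 + q^{n+1})).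
-- Both reduced series equal Σ_k (-1)^k a_k with a_k = Σ_s (-1)^s q^{k+1+s} (q^{k+1})_s.  On the
-- left this follows by expanding 1/(-q)_j = Σ_i (-q)^i (q^j)_i/(q)_i and swapping sums.  On the
-- right, expanding 1/(1 + q^{n+1}) leaves φ_k = Σ_n q^{(n+1)(n+2)/2 + (n+1)k}/(-q)_{n+1}, and
-- φ_k = a_k because both solve x_k = q^{k+1} - (1 - q^{k+1}) x_{k+1} with q^k dividing x_k.
-- Every infinite sum is of a family whose i-th member is divisible by q^i, so each
-- coefficient is a finite sum and sums may be swapped freely.

module Submission where

open import Defs
open import Data.Nat as ℕ using (ℕ; zero; suc; _+_; _*_; _∸_; _≤_; _<_; _⊔_; _≡ᵇ_; z≤n; s≤s)
import Data.Nat.Properties as ℕP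
import Data.Nat.DivMod as ℕD
open import Data.Nat.Tactic.RingSolver using (solve-∀)
open import Data.Integer as ℤ using (ℤ; +_; -_; 0ℤ; 1ℤ)
import Data.Integer.Properties as ℤP
open import Algebra.Properties.CommutativeSemigroup ℤP.+-commutativeSemigroup
  using () renaming (interchange to +-interchange)
open import Data.Bool using (true; false)
open import Data.Empty using (⊥-elim)
open import Data.Maybe using (Maybe; just; nothing)
open import Data.Product using (∃; _×_; _,_; Σ-syntax)
open import Relation.Nullary using (yes; no)
open import Relation.Binary.PropositionalEquality
open import Algebra.Bundles using (CommutativeRing)
open import Algebra.Structures using (IsCommutativeRing)
open import Algebra.Solver.Ring.AlmostCommutativeRing using (fromCommutativeRing; _-Raw-AlmostCommutative⟶_)
import Relation.Binary.Reasoning.Setoid as SetoidReasoning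

-- Finite sums of integers

sum-cong-< : ∀ n {f g : ℕ → ℤ} → (∀ i → i < n → f i ≡ g i) → sumℤ n f ≡ sumℤ n g
sum-cong-< zero    f≡g = refl
sum-cong-< (suc n) f≡g =
  cong₂ ℤ._+_ (sum-cong-< n (λ i i<n → f≡g i (ℕP.m<n⇒m<1+n i<n))) (f≡g n (ℕP.n<1+n n))

sum-cong : ∀ n {f g : ℕ → ℤ} → (∀ i → f i ≡ g i) → sumℤ n f ≡ sumℤ n g
sum-cong n f≡g = sum-cong-< n (λ i _ → f≡g i)

sum-zero : ∀ n {f : ℕ → ℤ} → (∀ i → i < n → f i ≡ 0ℤ) → sumℤ n f ≡ 0ℤ
sum-zero zero    f≡0 = refl
sum-zero (suc n) f≡0
  rewrite sum-zero n (λ i i<n → f≡0 i (ℕP.m<n⇒m<1+n i<n)) | f≡0 n (ℕP.n<1+n n) = refl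

sum-distrib-+ : ∀ n (f g : ℕ → ℤ) → sumℤ n (λ i → f i ℤ.+ g i) ≡ sumℤ n f ℤ.+ sumℤ n g
sum-distrib-+ zero    f g = refl
sum-distrib-+ (suc n) f g rewrite sum-distrib-+ n f g = +-interchange (sumℤ n f) (sumℤ n g) (f n) (g n)

*-distribˡ-sum : ∀ n c (f : ℕ → ℤ) → c ℤ.* sumℤ n f ≡ sumℤ n (λ i → c ℤ.* f i)
*-distribˡ-sum zero    c f = ℤP.*-zeroʳ c
*-distribˡ-sum (suc n) c f rewrite sym (*-distribˡ-sum n c f) = ℤP.*-distribˡ-+ c (sumℤ n f) (f n)

*-distribʳ-sum : ∀ n c (f : ℕ → ℤ) → sumℤ n f ℤ.* c ≡ sumℤ n (λ i → f i ℤ.* c)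
*-distribʳ-sum n c f = trans (ℤP.*-comm (sumℤ n f) c)
  (trans (*-distribˡ-sum n c f) (sum-cong n (λ i → ℤP.*-comm c (f i))))

neg-distrib-sum : ∀ n (f : ℕ → ℤ) → - sumℤ n f ≡ sumℤ n (λ i → - f i)
neg-distrib-sum zero    f = refl
neg-distrib-sum (suc n) f rewrite sym (neg-distrib-sum n f) = ℤP.neg-distrib-+ (sumℤ n f) (f n)

sum-first : ∀ n (f : ℕ → ℤ) → sumℤ (suc n) f ≡ f 0 ℤ.+ sumℤ n (λ i → f (suc i))
sum-first zero    f = trans (ℤP.+-identityˡ (f 0)) (sym (ℤP.+-identityʳ (f 0)))
sum-first (suc n) f rewrite sum-first n f = ℤP.+-assoc (f 0) _ _

sum-split : ∀ m n (f : ℕ → ℤ) → sumℤ (m + n) f ≡ sumℤ m f ℤ.+ sumℤ n (λ i → f (m + i))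
sum-split m zero    f rewrite ℕP.+-identityʳ m = sym (ℤP.+-identityʳ _)
sum-split m (suc n) f rewrite ℕP.+-suc m n | sum-split m n f = ℤP.+-assoc (sumℤ m f) _ _

sum-truncate : ∀ m n {f : ℕ → ℤ} → m ≤ n → (∀ i → m ≤ i → i < n → f i ≡ 0ℤ) →
               sumℤ n f ≡ sumℤ m f
sum-truncate m n {f} m≤n f≡0 with ℕP.m≤n⇒∃[o]m+o≡n m≤n
... | o , refl = begin
  sumℤ (m + o) f                        ≡⟨ sum-split m o f ⟩
  sumℤ m f ℤ.+ sumℤ o (λ i → f (m + i)) ≡⟨ cong (ℤ._+_ (sumℤ m f)) (sum-zero o tail≡0) ⟩
  sumℤ m f ℤ.+ 0ℤ                       ≡⟨ ℤP.+-identityʳ _ ⟩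
  sumℤ m f                              ∎
  where
  open ≡-Reasoning
  tail≡0 : ∀ i → i < o → f (m + i) ≡ 0ℤ
  tail≡0 i i<o = f≡0 (m + i) (ℕP.m≤m+n m i) (ℕP.+-monoʳ-< m i<o)

sum-swap : ∀ m n (f : ℕ → ℕ → ℤ) →
           sumℤ m (λ i → sumℤ n (f i)) ≡ sumℤ n (λ j → sumℤ m (λ i → f i j))
sum-swap zero    n f = sym (sum-zero n (λ _ _ → refl))
sum-swap (suc m) n f rewrite sum-swap m n f =
  sym (sum-distrib-+ n (λ j → sumℤ m (λ i → f i j)) (f m))

sum-reverse : ∀ n (f : ℕ → ℤ) → sumℤ n f ≡ sumℤ n (λ i → f (n ∸ suc i))
sum-reverse zero    f = refl
sum-reverse (suc n) f rewrite sum-first n (λ i → f (suc n ∸ suc i)) | sym (sum-reverse n f) =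
  ℤP.+-comm (sumℤ n f) (f n)

sum-triangle : ∀ N (g : ℕ → ℕ → ℤ) →
  sumℤ (suc N) (λ k → sumℤ (suc k) (g k)) ≡
  sumℤ (suc N) (λ i → sumℤ (suc (N ∸ i)) (λ j → g (i + j) i))
sum-triangle zero    g = refl
sum-triangle (suc N) g = begin
  sumℤ (2+N) (λ k → sumℤ (suc k) (g k))
    ≡⟨ sum-cong (2+N) (λ k → sum-first k (g k)) ⟩
  sumℤ (2+N) (λ k → g k 0 ℤ.+ sumℤ k (λ i → g k (suc i)))
    ≡⟨ sum-distrib-+ (2+N) (λ k → g k 0) _ ⟩
  sumℤ (2+N) (λ k → g k 0) ℤ.+ sumℤ (2+N) (λ k → sumℤ k (λ i → g k (suc i)))
    ≡⟨ cong (ℤ._+_ (sumℤ (2+N) (λ k → g k 0)))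
         (trans (sum-first (suc N) _) (ℤP.+-identityˡ _)) ⟩
  sumℤ (2+N) (λ k → g k 0) ℤ.+ sumℤ (suc N) (λ k → sumℤ (suc k) (λ i → g (suc k) (suc i)))
    ≡⟨ cong (ℤ._+_ (sumℤ (2+N) (λ k → g k 0))) (sum-triangle N (λ k i → g (suc k) (suc i))) ⟩
  sumℤ (2+N) (λ j → g j 0) ℤ.+ sumℤ (suc N) (λ i → sumℤ (suc (N ∸ i)) (λ j → g (suc i + j) (suc i)))
    ≡⟨ sym (sum-first (suc N) _) ⟩
  sumℤ (2+N) (λ i → sumℤ (suc (suc N ∸ i)) (λ j → g (i + j) i))
    ∎
  where
  open ≡-Reasoning
  2+N = suc (suc N)

-- The ring of formal power series

infix 4 _≈_
_≈_ : PS → PS → Set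
f ≈ g = ∀ N → f N ≡ g N

zeroPS : PS
zeroPS _ = 0ℤ

negPS : PS → PS
negPS f N = - f N

≈-refl : ∀ {f} → f ≈ f
≈-refl N = refl

≈-sym : ∀ {f g} → f ≈ g → g ≈ f
≈-sym f≈g N = sym (f≈g N)

≈-trans : ∀ {f g h} → f ≈ g → g ≈ h → f ≈ h
≈-trans f≈g g≈h N = trans (f≈g N) (g≈h N)

⊕-cong : ∀ {f f′ g g′} → f ≈ f′ → g ≈ g′ → f ⊕ g ≈ f′ ⊕ g′
⊕-cong f≈ g≈ N = cong₂ ℤ._+_ (f≈ N) (g≈ N)

⊖-cong : ∀ {f f′ g g′} → f ≈ f′ → g ≈ g′ → f ⊖ g ≈ f′ ⊖ g′
⊖-cong f≈ g≈ N = cong₂ ℤ._-_ (f≈ N) (g≈ N)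

negPS-cong : ∀ {f f′} → f ≈ f′ → negPS f ≈ negPS f′
negPS-cong f≈ N = cong -_ (f≈ N)

⊛-cong : ∀ {f f′ g g′} → f ≈ f′ → g ≈ g′ → f ⊛ g ≈ f′ ⊛ g′
⊛-cong f≈ g≈ N = sum-cong (suc N) (λ k → cong₂ ℤ._*_ (f≈ k) (g≈ (N ∸ k)))

⊛-comm : ∀ f g → f ⊛ g ≈ g ⊛ f
⊛-comm f g N = trans (sum-reverse (suc N) _) (sum-cong-< (suc N) swap)
  where
  swap : ∀ i → i < suc N → f (N ∸ i) ℤ.* g (N ∸ (N ∸ i)) ≡ g i ℤ.* f (N ∸ i)
  swap i (s≤s i≤N) rewrite ℕP.m∸[m∸n]≡n i≤N = ℤP.*-comm (f (N ∸ i)) (g i)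

⊛-distribˡ-⊕ : ∀ f g h → f ⊛ (g ⊕ h) ≈ f ⊛ g ⊕ f ⊛ h
⊛-distribˡ-⊕ f g h N = trans
  (sum-cong (suc N) (λ k → ℤP.*-distribˡ-+ (f k) (g (N ∸ k)) (h (N ∸ k))))
  (sum-distrib-+ (suc N) _ _)

⊛-distribʳ-⊕ : ∀ f g h → (g ⊕ h) ⊛ f ≈ g ⊛ f ⊕ h ⊛ f
⊛-distribʳ-⊕ f g h N = trans
  (sum-cong (suc N) (λ k → ℤP.*-distribʳ-+ (f (N ∸ k)) (g k) (h k)))
  (sum-distrib-+ (suc N) _ _)

⊛-assoc : ∀ f g h → (f ⊛ g) ⊛ h ≈ f ⊛ (g ⊛ h)
⊛-assoc f g h N = begin
  sumℤ (suc N) (λ k → sumℤ (suc k) (λ i → f i ℤ.* g (k ∸ i)) ℤ.* h (N ∸ k))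
    ≡⟨ sum-cong (suc N) (λ k → *-distribʳ-sum (suc k) (h (N ∸ k)) _) ⟩
  sumℤ (suc N) (λ k → sumℤ (suc k) (λ i → f i ℤ.* g (k ∸ i) ℤ.* h (N ∸ k)))
    ≡⟨ sum-triangle N (λ k i → f i ℤ.* g (k ∸ i) ℤ.* h (N ∸ k)) ⟩
  sumℤ (suc N) (λ i → sumℤ (suc (N ∸ i)) (λ j → f i ℤ.* g (i + j ∸ i) ℤ.* h (N ∸ (i + j))))
    ≡⟨ sum-cong (suc N) (λ i → sum-cong (suc (N ∸ i)) (reindex i)) ⟩
  sumℤ (suc N) (λ i → sumℤ (suc (N ∸ i)) (λ j → f i ℤ.* (g j ℤ.* h (N ∸ i ∸ j))))
    ≡⟨ sum-cong (suc N) (λ i → sym (*-distribˡ-sum (suc (N ∸ i)) (f i) _)) ⟩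
  sumℤ (suc N) (λ i → f i ℤ.* sumℤ (suc (N ∸ i)) (λ j → g j ℤ.* h (N ∸ i ∸ j)))
    ∎
  where
  open ≡-Reasoning
  reindex : ∀ i j → f i ℤ.* g (i + j ∸ i) ℤ.* h (N ∸ (i + j)) ≡ f i ℤ.* (g j ℤ.* h (N ∸ i ∸ j))
  reindex i j rewrite ℕP.m+n∸m≡n i j | sym (ℕP.∸-+-assoc N i j) = ℤP.*-assoc (f i) (g j) _

⊛-identityˡ : ∀ f → one ⊛ f ≈ f
⊛-identityˡ f N = begin
  sumℤ (suc N) (λ k → one k ℤ.* f (N ∸ k))
    ≡⟨ sum-first N _ ⟩
  1ℤ ℤ.* f N ℤ.+ sumℤ N (λ i → 0ℤ ℤ.* f (N ∸ suc i))
    ≡⟨ cong₂ ℤ._+_ (ℤP.*-identityˡ (f N)) (sum-zero N (λ i _ → ℤP.*-zeroˡ (f (N ∸ suc i)))) ⟩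
  f N ℤ.+ 0ℤ
    ≡⟨ ℤP.+-identityʳ (f N) ⟩
  f N
    ∎
  where open ≡-Reasoning

⊛-identityʳ : ∀ f → f ⊛ one ≈ f
⊛-identityʳ f = ≈-trans (⊛-comm f one) (⊛-identityˡ f)

⊛-zeroˡ : ∀ f → zeroPS ⊛ f ≈ zeroPS
⊛-zeroˡ f N = sum-zero (suc N) (λ i _ → ℤP.*-zeroˡ (f (N ∸ i)))

PS-isCommutativeRing : IsCommutativeRing _≈_ _⊕_ _⊛_ negPS zeroPS one
PS-isCommutativeRing = record
  { isRing = record
    { +-isAbelianGroup = record
      { isGroup = record
        { isMonoid = record
          { isSemigroup = record
            { isMagma = record
              { isEquivalence = record { refl = ≈-refl ; sym = ≈-sym ; trans = ≈-trans }
              ; ∙-cong = ⊕-cong }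
            ; assoc = λ f g h N → ℤP.+-assoc (f N) (g N) (h N) }
          ; identity = (λ f N → ℤP.+-identityˡ (f N)) , (λ f N → ℤP.+-identityʳ (f N)) }
        ; inverse = (λ f N → ℤP.+-inverseˡ (f N)) , (λ f N → ℤP.+-inverseʳ (f N))
        ; ⁻¹-cong = negPS-cong }
      ; comm = λ f g N → ℤP.+-comm (f N) (g N) }
    ; *-cong = ⊛-cong
    ; *-assoc = ⊛-assoc
    ; *-identity = ⊛-identityˡ , ⊛-identityʳ
    ; distrib = ⊛-distribˡ-⊕ , ⊛-distribʳ-⊕ }
  ; *-comm = ⊛-comm }

PS-commutativeRing : CommutativeRing _ _
PS-commutativeRing = record { isCommutativeRing = PS-isCommutativeRing }

module ≈-Reasoning = SetoidReasoning (CommutativeRing.setoid PS-commutativeRing)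

≡ᵇ-refl : ∀ k → (k ≡ᵇ k) ≡ true
≡ᵇ-refl zero    = refl
≡ᵇ-refl (suc k) = ≡ᵇ-refl k

≢⇒≡ᵇ≡false : ∀ n k → n ≢ k → (n ≡ᵇ k) ≡ false
≢⇒≡ᵇ≡false zero    zero    n≢k = ⊥-elim (n≢k refl)
≢⇒≡ᵇ≡false zero    (suc k) n≢k = refl
≢⇒≡ᵇ≡false (suc n) zero    n≢k = refl
≢⇒≡ᵇ≡false (suc n) (suc k) n≢k = ≢⇒≡ᵇ≡false n k (λ n≡k → n≢k (cong suc n≡k))

mono-≡ : ∀ c k → mono c k k ≡ c
mono-≡ c k rewrite ≡ᵇ-refl k = refl

mono-≢ : ∀ c k n → n ≢ k → mono c k n ≡ 0ℤ
mono-≢ c k n n≢k rewrite ≢⇒≡ᵇ≡false n k n≢k = refl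

sum-mono-*-≥ : ∀ n c k (h : ℕ → ℤ) → n ≤ k → sumℤ n (λ i → mono c k i ℤ.* h i) ≡ 0ℤ
sum-mono-*-≥ n c k h n≤k = sum-zero n λ i i<n →
  trans (cong (ℤ._* h i) (mono-≢ c k i (ℕP.<⇒≢ (ℕP.<-≤-trans i<n n≤k)))) (ℤP.*-zeroˡ (h i))

sum-mono-* : ∀ n c k (h : ℕ → ℤ) → k < n → sumℤ n (λ i → mono c k i ℤ.* h i) ≡ c ℤ.* h k
sum-mono-* (suc n) c k h k<1+n with n ℕ.≟ k
... | yes refl = trans
  (cong₂ ℤ._+_ (sum-mono-*-≥ n c n h ℕP.≤-refl) (cong (ℤ._* h n) (mono-≡ c n)))
  (ℤP.+-identityˡ _)
... | no n≢k = trans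
  (cong₂ ℤ._+_ (sum-mono-* n c k h (ℕP.≤∧≢⇒< (ℕP.≤-pred k<1+n) (≢-sym n≢k)))
             (trans (cong (ℤ._* h n) (mono-≢ c k n n≢k)) (ℤP.*-zeroˡ (h n))))
  (ℤP.+-identityʳ _)

mono-⊛-≤ : ∀ c k f N → k ≤ N → (mono c k ⊛ f) N ≡ c ℤ.* f (N ∸ k)
mono-⊛-≤ c k f N k≤N = sum-mono-* (suc N) c k (λ j → f (N ∸ j)) (s≤s k≤N)

mono-⊛-> : ∀ c k f N → N < k → (mono c k ⊛ f) N ≡ 0ℤ
mono-⊛-> c k f N N<k = sum-mono-*-≥ (suc N) c k (λ j → f (N ∸ j)) N<k

mono-⊛-mono : ∀ a b j k → mono a j ⊛ mono b k ≈ mono (a ℤ.* b) (j + k)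
mono-⊛-mono a b j k N with j ℕ.≤? N
... | no j≰N = trans (mono-⊛-> a j (mono b k) N (ℕP.≰⇒> j≰N))
  (sym (mono-≢ (a ℤ.* b) (j + k) N λ N≡j+k → j≰N (subst (j ≤_) (sym N≡j+k) (ℕP.m≤m+n j k))))
... | yes j≤N with N ℕ.≟ j + k
...   | yes refl = begin
  (mono a j ⊛ mono b k) (j + k)  ≡⟨ mono-⊛-≤ a j (mono b k) N j≤N ⟩
  a ℤ.* mono b k (j + k ∸ j)     ≡⟨ cong (λ n → a ℤ.* mono b k n) (ℕP.m+n∸m≡n j k) ⟩
  a ℤ.* mono b k k               ≡⟨ cong (a ℤ.*_) (mono-≡ b k) ⟩
  a ℤ.* b                        ≡⟨ mono-≡ (a ℤ.* b) (j + k) ⟨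
  mono (a ℤ.* b) (j + k) (j + k) ∎
  where open ≡-Reasoning
...   | no N≢j+k = begin
  (mono a j ⊛ mono b k) N  ≡⟨ mono-⊛-≤ a j (mono b k) N j≤N ⟩
  a ℤ.* mono b k (N ∸ j)   ≡⟨ cong (a ℤ.*_) (mono-≢ b k (N ∸ j) N∸j≢k) ⟩
  a ℤ.* 0ℤ                 ≡⟨ ℤP.*-zeroʳ a ⟩
  0ℤ                       ≡⟨ mono-≢ (a ℤ.* b) (j + k) N N≢j+k ⟨
  mono (a ℤ.* b) (j + k) N ∎
  where
  open ≡-Reasoning
  N∸j≢k : N ∸ j ≢ k
  N∸j≢k N∸j≡k = N≢j+k (trans (sym (ℕP.m+[n∸m]≡n j≤N)) (cong (_+_ j) N∸j≡k))

mono-neg : ∀ c k → mono (- c) k ≈ negPS (mono c k)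
mono-neg c k N with N ≡ᵇ k
... | true  = refl
... | false = refl

mono-zero : ∀ k → mono 0ℤ k ≈ zeroPS
mono-zero k N with N ≡ᵇ k
... | true  = refl
... | false = refl

qpow-+ : ∀ m n → qpow (m + n) ≈ qpow m ⊛ qpow n
qpow-+ m n = ≈-sym (mono-⊛-mono 1ℤ 1ℤ m n)

qpow-cong : ∀ {m n} → m ≡ n → qpow m ≈ qpow n
qpow-cong refl = ≈-refl

mono≈const⊛qpow : ∀ c k → mono c k ≈ mono c 0 ⊛ qpow k
mono≈const⊛qpow c k N =
  sym (trans (mono-⊛-mono c 1ℤ 0 k N) (cong (λ a → mono a k N) (ℤP.*-identityʳ c)))

mono-suc : ∀ c i → mono c (suc i) ≈ mono c i ⊛ qpow 1
mono-suc c i N = sym (trans (mono-⊛-mono c 1ℤ i 1 N)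
  (cong₂ (λ a e → mono a e N) (ℤP.*-identityʳ c) (ℕP.+-comm i 1)))

-- Ring solver on power series; an integer constant c is interpreted as mono c 0.

constant-homomorphism : ℤ.+-*-rawRing -Raw-AlmostCommutative⟶ fromCommutativeRing PS-commutativeRing
constant-homomorphism = record
  { ⟦_⟧    = λ c → mono c 0
  ; +-homo = λ a b → λ { zero → refl ; (suc N) → refl }
  ; *-homo = λ a b → ≈-sym (mono-⊛-mono a b 0 0)
  ; -‿homo = λ a → λ { zero → refl ; (suc N) → refl }
  ; 0-homo = λ { zero → refl ; (suc N) → refl }
  ; 1-homo = λ N → refl }

constants-equal? : ∀ a b → Maybe (mono a 0 ≈ mono b 0)
constants-equal? a b with a ℤ.≟ b
... | yes refl = just ≈-refl
... | no _     = nothing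

open import Algebra.Solver.Ring ℤ.+-*-rawRing (fromCommutativeRing PS-commutativeRing)
  constant-homomorphism constants-equal?
  using (solve; _:=_; _:+_; _:-_; _:*_; :-_; con)

-- Divisibility by powers of q and truncated equality

infix 4 q^_∣_ _≈[≤_]_

q^_∣_ : ℕ → PS → Set
q^ k ∣ f = ∀ i → i < k → f i ≡ 0ℤ

_≈[≤_]_ : PS → ℕ → PS → Set
f ≈[≤ N ] g = ∀ k → k ≤ N → f k ≡ g k

q^∣-≈ : ∀ {k f g} → f ≈ g → q^ k ∣ f → q^ k ∣ g
q^∣-≈ f≈g k∣f i i<k = trans (sym (f≈g i)) (k∣f i i<k)

q^∣-weaken : ∀ {j k f} → j ≤ k → q^ k ∣ f → q^ j ∣ f
q^∣-weaken j≤k k∣f i i<j = k∣f i (ℕP.<-≤-trans i<j j≤k)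

q^∣-⊖ : ∀ {k f g} → q^ k ∣ f → q^ k ∣ g → q^ k ∣ f ⊖ g
q^∣-⊖ k∣f k∣g i i<k rewrite k∣f i i<k | k∣g i i<k = refl

q^∣-⊛ : ∀ {a b f g} → q^ a ∣ f → q^ b ∣ g → q^ (a + b) ∣ f ⊛ g
q^∣-⊛ {a} {b} {f} {g} a∣f b∣g i i<a+b = sum-zero (suc i) term≡0
  where
  term≡0 : ∀ j → j < suc i → f j ℤ.* g (i ∸ j) ≡ 0ℤ
  term≡0 j j<1+i with j ℕ.<? a
  ... | yes j<a = trans (cong (ℤ._* g (i ∸ j)) (a∣f j j<a)) (ℤP.*-zeroˡ (g (i ∸ j)))
  ... | no  j≮a = trans (cong (f j ℤ.*_) (b∣g (i ∸ j) (ℕP.+-cancelˡ-< j (i ∸ j) b j+[i∸j]<j+b)))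
                        (ℤP.*-zeroʳ (f j))
    where
    j+[i∸j]<j+b : j + (i ∸ j) < j + b
    j+[i∸j]<j+b rewrite ℕP.m+[n∸m]≡n (ℕP.≤-pred j<1+i) =
      ℕP.<-≤-trans i<a+b (ℕP.+-monoˡ-≤ b (ℕP.≮⇒≥ j≮a))

q^∣-⊛ˡ : ∀ {k f} g → q^ k ∣ f → q^ k ∣ f ⊛ g
q^∣-⊛ˡ {k} g k∣f = subst (λ m → q^ m ∣ _) (ℕP.+-identityʳ k) (q^∣-⊛ {g = g} k∣f λ _ ())

q^∣-⊛ʳ : ∀ {k g} f → q^ k ∣ g → q^ k ∣ f ⊛ g
q^∣-⊛ʳ {k} {g} f k∣g = q^∣-≈ (⊛-comm g f) (q^∣-⊛ˡ f k∣g)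

q^∣-mono : ∀ c k → q^ k ∣ mono c k
q^∣-mono c k i i<k = mono-≢ c k i (ℕP.<⇒≢ i<k)

q^∣-pow : ∀ {u} k → q^ 1 ∣ u → q^ k ∣ pow u k
q^∣-pow zero    _     _ ()
q^∣-pow {u} (suc k) 1∣u = subst (λ m → q^ m ∣ pow u (suc k)) (ℕP.+-comm k 1) (q^∣-⊛ (q^∣-pow k 1∣u) 1∣u)

q^∣-⊖⇒≈[≤] : ∀ {f g} N → q^ suc N ∣ f ⊖ g → f ≈[≤ N ] g
q^∣-⊖⇒≈[≤] {f} {g} N N∣f-g k k≤N = ℤP.i-j≡0⇒i≡j (f k) (g k) (N∣f-g k (s≤s k≤N))

≈⇒≈[≤] : ∀ {f g} N → f ≈ g → f ≈[≤ N ] g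
≈⇒≈[≤] N f≈g k _ = f≈g k

≈[≤]⇒≈ : ∀ {f g} → (∀ N → f ≈[≤ N ] g) → f ≈ g
≈[≤]⇒≈ f≈g N = f≈g N N ℕP.≤-refl

≈[≤]-refl : ∀ {f} N → f ≈[≤ N ] f
≈[≤]-refl N k _ = refl

≈[≤]-sym : ∀ {f g N} → f ≈[≤ N ] g → g ≈[≤ N ] f
≈[≤]-sym f≈g k k≤N = sym (f≈g k k≤N)

≈[≤]-trans : ∀ {f g h N} → f ≈[≤ N ] g → g ≈[≤ N ] h → f ≈[≤ N ] h
≈[≤]-trans f≈g g≈h k k≤N = trans (f≈g k k≤N) (g≈h k k≤N)

≈[≤]-weaken : ∀ {f g M N} → N ≤ M → f ≈[≤ M ] g → f ≈[≤ N ] g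
≈[≤]-weaken N≤M f≈g k k≤N = f≈g k (ℕP.≤-trans k≤N N≤M)

≈[≤]-⊖ : ∀ {f f′ g g′ N} → f ≈[≤ N ] f′ → g ≈[≤ N ] g′ → f ⊖ g ≈[≤ N ] f′ ⊖ g′
≈[≤]-⊖ f≈ g≈ k k≤N = cong₂ ℤ._-_ (f≈ k k≤N) (g≈ k k≤N)

≈[≤]-⊛ : ∀ {f f′ g g′ N} → f ≈[≤ N ] f′ → g ≈[≤ N ] g′ → f ⊛ g ≈[≤ N ] f′ ⊛ g′
≈[≤]-⊛ f≈ g≈ k k≤N = sum-cong-< (suc k) λ j j<1+k → cong₂ ℤ._*_
  (f≈ j (ℕP.≤-trans (ℕP.≤-pred j<1+k) k≤N))
  (g≈ (k ∸ j) (ℕP.≤-trans (ℕP.m∸n≤m k j) k≤N))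

one⊖-≈[≤] : ∀ {x} N → q^ suc N ∣ x → one ⊖ x ≈[≤ N ] one
one⊖-≈[≤] {x} N N∣x k k≤N rewrite N∣x k (s≤s k≤N) = ℤP.+-identityʳ (one k)

-- Inverses of series with constant term one

ConstTermOne : PS → Set
ConstTermOne f = f 0 ≡ 1ℤ

ConstTermOne-⊛ : ∀ {f g} → ConstTermOne f → ConstTermOne g → ConstTermOne (f ⊛ g)
ConstTermOne-⊛ f₀≡1 g₀≡1 rewrite f₀≡1 | g₀≡1 = refl

ConstTermOne-one⊖ : ∀ {u} → q^ 1 ∣ u → ConstTermOne (one ⊖ u)
ConstTermOne-one⊖ 1∣u rewrite 1∣u 0 (s≤s z≤n) = refl

ConstTermOne-one⊕ : ∀ {u} → q^ 1 ∣ u → ConstTermOne (one ⊕ u)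
ConstTermOne-one⊕ 1∣u rewrite 1∣u 0 (s≤s z≤n) = refl

ConstTermOne-prodPS : ∀ L (F : ℕ → PS) → (∀ i → ConstTermOne (F i)) → ConstTermOne (prodPS L F)
ConstTermOne-prodPS zero    F F₀≡1 = refl
ConstTermOne-prodPS (suc L) F F₀≡1 = ConstTermOne-⊛ {prodPS L F} {F L} (ConstTermOne-prodPS L F F₀≡1) (F₀≡1 L)

pow-≈[≤] : ∀ {u v N} k → u ≈[≤ N ] v → pow u k ≈[≤ N ] pow v k
pow-≈[≤] zero    u≈v = ≈[≤]-refl _
pow-≈[≤] (suc k) u≈v = ≈[≤]-⊛ (pow-≈[≤] k u≈v) u≈v

inv-≈[≤] : ∀ {f g N} → f ≈[≤ N ] g → inv f ≈[≤ N ] inv g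
inv-≈[≤] {N = N} f≈g n n≤N =
  sum-cong (suc n) (λ k → pow-≈[≤] k (≈[≤]-⊖ {f = one} (≈[≤]-refl N) f≈g) n n≤N)

inv-cong : ∀ {f g} → f ≈ g → inv f ≈ inv g
inv-cong f≈g = ≈[≤]⇒≈ (λ N → inv-≈[≤] (≈⇒≈[≤] N f≈g))

geometric-sum : ∀ u M → sumPS M (pow u) ⊛ (one ⊖ u) ≈ one ⊖ pow u M
geometric-sum u zero    N = trans (⊛-zeroˡ (one ⊖ u) N) (sym (ℤP.+-inverseʳ (one N)))
geometric-sum u (suc M) = begin
  (sumPS M (pow u) ⊕ pow u M) ⊛ (one ⊖ u)
    ≈⟨ ⊛-distribʳ-⊕ (one ⊖ u) (sumPS M (pow u)) (pow u M) ⟩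
  sumPS M (pow u) ⊛ (one ⊖ u) ⊕ pow u M ⊛ (one ⊖ u)
    ≈⟨ ⊕-cong (geometric-sum u M) ≈-refl ⟩
  (one ⊖ pow u M) ⊕ pow u M ⊛ (one ⊖ u)
    ≈⟨ solve 2 (λ p u → (con 1ℤ :- p) :+ p :* (con 1ℤ :- u) := con 1ℤ :- p :* u) ≈-refl (pow u M) u ⟩
  one ⊖ pow u M ⊛ u
    ∎
  where open ≈-Reasoning

inv-≈[≤]-geometric : ∀ f N → q^ 1 ∣ one ⊖ f → inv f ≈[≤ N ] sumPS (suc N) (pow (one ⊖ f))
inv-≈[≤]-geometric f N 1∣1-f n n≤N =
  sym (sum-truncate (suc n) (suc N) (s≤s n≤N) (λ i 1+n≤i _ → q^∣-pow i 1∣1-f n 1+n≤i))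

inv-inverseˡ : ∀ f → ConstTermOne f → inv f ⊛ f ≈ one
inv-inverseˡ f f₀≡1 = ≈[≤]⇒≈ λ N →
  ≈[≤]-trans (≈[≤]-⊛ (inv-≈[≤]-geometric f N 1∣u) (≈⇒≈[≤] N f≈1-u))
  (≈[≤]-trans (≈⇒≈[≤] N (geometric-sum u (suc N)))
              (one⊖-≈[≤] N (q^∣-pow (suc N) 1∣u)))
  where
  u = one ⊖ f
  1∣u : q^ 1 ∣ u
  1∣u zero    _ rewrite f₀≡1 = refl
  1∣u (suc i) (s≤s ())
  f≈1-u : f ≈ one ⊖ u
  f≈1-u = solve 1 (λ f → f := con 1ℤ :- (con 1ℤ :- f)) ≈-refl f

inv-inverseʳ : ∀ f → ConstTermOne f → f ⊛ inv f ≈ one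
inv-inverseʳ f f₀≡1 = ≈-trans (⊛-comm f (inv f)) (inv-inverseˡ f f₀≡1)

⊛-cancelʳ-≈[≤] : ∀ {u f g N} → ConstTermOne u → f ⊛ u ≈[≤ N ] g ⊛ u → f ≈[≤ N ] g
⊛-cancelʳ-≈[≤] {u} {f} {g} {N} u₀≡1 fu≈gu =
  ≈[≤]-trans (≈⇒≈[≤] N (≈-sym (cancel f)))
  (≈[≤]-trans (≈[≤]-⊛ fu≈gu (≈[≤]-refl {inv u} N)) (≈⇒≈[≤] N (cancel g)))
  where
  cancel : ∀ h → (h ⊛ u) ⊛ inv u ≈ h
  cancel h = ≈-trans (⊛-assoc h u (inv u))
             (≈-trans (⊛-cong (≈-refl {h}) (inv-inverseʳ u u₀≡1)) (⊛-identityʳ h))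

⊛-cancelʳ : ∀ {u f g} → ConstTermOne u → f ⊛ u ≈ g ⊛ u → f ≈ g
⊛-cancelʳ {u} {f} {g} u₀≡1 fu≈gu =
  ≈[≤]⇒≈ (λ N → ⊛-cancelʳ-≈[≤] {u} {f} {g} u₀≡1 (≈⇒≈[≤] N fu≈gu))

inv-unique : ∀ {f g} → ConstTermOne f → g ⊛ f ≈ one → g ≈ inv f
inv-unique {f} {g} f₀≡1 gf≈1 = ⊛-cancelʳ {f} {g} f₀≡1 (≈-trans gf≈1 (≈-sym (inv-inverseˡ f f₀≡1)))

inv-one : inv one ≈ one
inv-one = ≈-sym (inv-unique refl (⊛-identityˡ one))

inv-⊛ : ∀ f g → ConstTermOne f → ConstTermOne g → inv (f ⊛ g) ≈ inv f ⊛ inv g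
inv-⊛ f g f₀≡1 g₀≡1 = ≈-sym (inv-unique (ConstTermOne-⊛ {f} {g} f₀≡1 g₀≡1) (begin
  (inv f ⊛ inv g) ⊛ (f ⊛ g)
    ≈⟨ solve 4 (λ a b x y → (a :* b) :* (x :* y) := (a :* x) :* (b :* y)) ≈-refl (inv f) (inv g) f g ⟩
  (inv f ⊛ f) ⊛ (inv g ⊛ g)
    ≈⟨ ⊛-cong (inv-inverseˡ f f₀≡1) (inv-inverseˡ g g₀≡1) ⟩
  one ⊛ one
    ≈⟨ ⊛-identityˡ one ⟩
  one
    ∎))
  where open ≈-Reasoning

-- Summable families

Summable : (ℕ → PS) → Set
Summable F = ∀ i → q^ i ∣ F i

Σ∞ : (ℕ → PS) → PS
Σ∞ F N = sumℤ (suc N) (λ i → F i N)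

Σ∞-cong : ∀ {F G} → (∀ i → F i ≈ G i) → Σ∞ F ≈ Σ∞ G
Σ∞-cong F≈G N = sum-cong (suc N) (λ i → F≈G i N)

Σ∞-⊕ : ∀ F G → Σ∞ (λ i → F i ⊕ G i) ≈ Σ∞ F ⊕ Σ∞ G
Σ∞-⊕ F G N = sum-distrib-+ (suc N) (λ i → F i N) (λ i → G i N)

Σ∞-negPS : ∀ F → Σ∞ (λ i → negPS (F i)) ≈ negPS (Σ∞ F)
Σ∞-negPS F N = sym (neg-distrib-sum (suc N) (λ i → F i N))

q^∣-Σ∞ : ∀ {k} F → (∀ j → q^ k ∣ F j) → q^ k ∣ Σ∞ F
q^∣-Σ∞ F k∣F n n<k = sum-zero (suc n) (λ j _ → k∣F j n n<k)

Σ∞-swap : ∀ (F : ℕ → ℕ → PS) → Σ∞ (λ i → Σ∞ (F i)) ≈ Σ∞ (λ j → Σ∞ (λ i → F i j))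
Σ∞-swap F N = sum-swap (suc N) (suc N) (λ i j → F i j N)

Σ∞-first : ∀ F → Summable F → Σ∞ F ≈ F 0 ⊕ Σ∞ (λ i → F (suc i))
Σ∞-first F F-summable N = trans (sum-first N (λ i → F i N)) (cong (ℤ._+_ (F 0 N)) (sym
  (trans (cong (ℤ._+_ (sumℤ N (λ i → F (suc i) N))) (F-summable (suc N) N ℕP.≤-refl))
         (ℤP.+-identityʳ _))))

Σ∞-⊖ : ∀ F G → Σ∞ (λ i → F i ⊖ G i) ≈ Σ∞ F ⊖ Σ∞ G
Σ∞-⊖ F G N = trans (sum-distrib-+ (suc N) (λ i → F i N) (λ i → - G i N))
                   (cong (ℤ._+_ (Σ∞ F N)) (sym (neg-distrib-sum (suc N) (λ i → G i N))))

Σ∞-from-1 : ∀ F → Summable F → F 0 ≈ zeroPS → Σ∞ F ≈ Σ∞ (λ i → F (suc i))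
Σ∞-from-1 F F-summable F₀≈0 N = trans (Σ∞-first F F-summable N)
  (trans (cong (ℤ._+ Σ∞ (λ i → F (suc i)) N) (F₀≈0 N)) (ℤP.+-identityˡ _))

Σ∞-telescope : ∀ F → Summable F → Σ∞ (λ i → F i ⊖ F (suc i)) ≈ F 0
Σ∞-telescope F F-summable = begin
  Σ∞ (λ i → F i ⊖ F (suc i))  ≈⟨ Σ∞-⊖ F (λ i → F (suc i)) ⟩
  Σ∞ F ⊖ Σ∞ (λ i → F (suc i)) ≈⟨ ⊖-cong (Σ∞-first F F-summable) ≈-refl ⟩
  (F 0 ⊕ Σ∞ (λ i → F (suc i))) ⊖ Σ∞ (λ i → F (suc i))
    ≈⟨ solve 2 (λ f s → (f :+ s) :- s := f) ≈-refl (F 0) (Σ∞ (λ i → F (suc i))) ⟩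
  F 0                                     ∎
  where open ≈-Reasoning

⊛-distribˡ-Σ∞ : ∀ c F → Summable F → c ⊛ Σ∞ F ≈ Σ∞ (λ i → c ⊛ F i)
⊛-distribˡ-Σ∞ c F F-summable N = begin
  sumℤ (suc N) (λ k → c k ℤ.* sumℤ (suc (N ∸ k)) (λ i → F i (N ∸ k)))
    ≡⟨ sum-cong (suc N) (λ k → cong (c k ℤ.*_) (sym (pad k))) ⟩
  sumℤ (suc N) (λ k → c k ℤ.* sumℤ (suc N) (λ i → F i (N ∸ k)))
    ≡⟨ sum-cong (suc N) (λ k → *-distribˡ-sum (suc N) (c k) _) ⟩
  sumℤ (suc N) (λ k → sumℤ (suc N) (λ i → c k ℤ.* F i (N ∸ k)))
    ≡⟨ sum-swap (suc N) (suc N) _ ⟩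
  sumℤ (suc N) (λ i → sumℤ (suc N) (λ k → c k ℤ.* F i (N ∸ k)))
    ∎
  where
  open ≡-Reasoning
  pad : ∀ k → sumℤ (suc N) (λ i → F i (N ∸ k)) ≡ sumℤ (suc (N ∸ k)) (λ i → F i (N ∸ k))
  pad k = sum-truncate (suc (N ∸ k)) (suc N) (s≤s (ℕP.m∸n≤m N k))
            (λ i N∸k<i _ → F-summable i (N ∸ k) N∸k<i)

⊛-distribʳ-Σ∞ : ∀ c F → Summable F → Σ∞ F ⊛ c ≈ Σ∞ (λ i → F i ⊛ c)
⊛-distribʳ-Σ∞ c F F-summable = ≈-trans (⊛-comm (Σ∞ F) c)
  (≈-trans (⊛-distribˡ-Σ∞ c F F-summable) (Σ∞-cong (λ i → ⊛-comm c (F i))))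

Summable-≈ : ∀ {F G} → (∀ i → F i ≈ G i) → Summable F → Summable G
Summable-≈ F≈G F-summable i = q^∣-≈ (F≈G i) (F-summable i)

Summable-⊛ : ∀ c {F} → Summable F → Summable (λ i → c ⊛ F i)
Summable-⊛ c F-summable i = q^∣-⊛ʳ c (F-summable i)

partial-sums-converge : ∀ F → Summable F → Converges (λ M → sumPS M F) (Σ∞ F)
partial-sums-converge F F-summable N = suc N , λ M N<M →
  sum-truncate (suc N) M N<M (λ i N<i _ → F-summable i N N<i)

Converges-≈ : ∀ {S T T′} → Converges S T → T ≈ T′ → Converges S T′
Converges-≈ S→T T≈T′ N with S→T N
... | M₀ , stable = M₀ , λ M M₀≤M → trans (stable M M₀≤M) (T≈T′ N)

recurrence-iterate : ∀ (e c : ℕ → PS) → (∀ k → e k ≈ c k ⊛ e (suc k)) →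
                     ∀ M k → Σ[ p ∈ PS ] (e k ≈ p ⊛ e (M + k))
recurrence-iterate e c e-rec zero    k = one , ≈-sym (⊛-identityˡ (e k))
recurrence-iterate e c e-rec (suc M) k =
  let p , ek≈p⊛e = recurrence-iterate e c e-rec M k
  in p ⊛ c (M + k) , ≈-trans ek≈p⊛e
       (≈-trans (⊛-cong (≈-refl {p}) (e-rec (M + k)))
                (≈-sym (⊛-assoc p (c (M + k)) (e (suc (M + k))))))

recurrence-vanishing : ∀ (e c : ℕ → PS) → (∀ k → e k ≈ c k ⊛ e (suc k)) → Summable e →
                       ∀ k → e k ≈ zeroPS
recurrence-vanishing e c e-rec e-summable k N =
  let p , ek≈p⊛e = recurrence-iterate e c e-rec (suc N) k
  in trans (ek≈p⊛e N) (q^∣-⊛ʳ p (e-summable (suc N + k)) N (s≤s (ℕP.m≤m+n N k)))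

-- Finite products and q-Pochhammer symbols

prodPS-cong : ∀ L {F G : ℕ → PS} → (∀ i → F i ≈ G i) → prodPS L F ≈ prodPS L G
prodPS-cong zero    F≈G = ≈-refl
prodPS-cong (suc L) F≈G = ⊛-cong (prodPS-cong L F≈G) (F≈G L)

prodPS-split : ∀ m n (F : ℕ → PS) → prodPS (m + n) F ≈ prodPS m F ⊛ prodPS n (λ i → F (m + i))
prodPS-split m zero    F rewrite ℕP.+-identityʳ m = ≈-sym (⊛-identityʳ (prodPS m F))
prodPS-split m (suc n) F rewrite ℕP.+-suc m n = ≈-trans
  (⊛-cong (prodPS-split m n F) (≈-refl {F (m + n)}))
  (⊛-assoc (prodPS m F) (prodPS n (λ i → F (m + i))) (F (m + n)))

prodPS-stable : ∀ {N L} (F : ℕ → PS) → (∀ i → L ≤ i → F i ≈[≤ N ] one) →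
                ∀ d → prodPS (L + d) F ≈[≤ N ] prodPS L F
prodPS-stable {N} {L} F F≈1 zero rewrite ℕP.+-identityʳ L = ≈[≤]-refl N
prodPS-stable {N} {L} F F≈1 (suc d) rewrite ℕP.+-suc L d =
  ≈[≤]-trans (≈[≤]-⊛ (prodPS-stable F F≈1 d) (F≈1 (L + d) (ℕP.m≤m+n L d)))
             (≈⇒≈[≤] N (⊛-identityʳ (prodPS L F)))

limit-≈[≤]-prodPS : ∀ (F : ℕ → PS) R N L → Converges (λ M → prodPS M F) R →
                    (∀ i → L ≤ i → F i ≈[≤ N ] one) → R ≈[≤ N ] prodPS L F
limit-≈[≤]-prodPS F R N L prods→R F≈1 k k≤N =
  let M₀ , stable = prods→R k
      M = M₀ ⊔ L
  in trans (sym (stable M (ℕP.m≤m⊔n M₀ L)))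
       (subst (λ m → prodPS m F k ≡ prodPS L F k) (ℕP.m+[n∸m]≡n (ℕP.m≤n⊔m M₀ L))
         (prodPS-stable F F≈1 (M ∸ L) k k≤N))

poch⁺ : ℕ → ℕ → PS
poch⁺ m L = poch (qpow m) L

poch⁻ : ℕ → ℕ → PS
poch⁻ m L = poch (negqpow m) L

poch-mono-factor : ∀ c m i → one ⊖ mono c m ⊛ mono 1ℤ i ≈ one ⊖ mono c (m + i)
poch-mono-factor c m i N = cong (ℤ._-_ (one N))
  (trans (mono-⊛-mono c 1ℤ m i N) (cong (λ a → mono a (m + i) N) (ℤP.*-identityʳ c)))

poch-mono-split : ∀ c m L K → poch (mono c m) (L + K) ≈ poch (mono c m) L ⊛ poch (mono c (m + L)) K
poch-mono-split c m L K = ≈-trans (prodPS-split L K _) (⊛-cong (≈-refl {poch (mono c m) L}) (prodPS-cong K λ i →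
  ≈-trans (poch-mono-factor c m (L + i))
  (≈-trans (λ N → cong (λ e → one N ℤ.- mono c e N) (sym (ℕP.+-assoc m L i)))
           (≈-sym (poch-mono-factor c (m + L) i)))))

one⊖negqpow : ∀ n → one ⊖ negqpow n ≈ one ⊕ qpow n
one⊖negqpow n N = trans (cong (ℤ._-_ (one N)) (mono-neg 1ℤ n N))
                        (cong (ℤ._+_ (one N)) (ℤP.neg-involutive (qpow n N)))

poch⁺-snoc : ∀ m L → poch⁺ m (suc L) ≈ poch⁺ m L ⊛ (one ⊖ qpow (m + L))
poch⁺-snoc m L = ⊛-cong (≈-refl {poch⁺ m L}) (poch-mono-factor 1ℤ m L)

poch⁻-snoc : ∀ m L → poch⁻ m (suc L) ≈ poch⁻ m L ⊛ (one ⊕ qpow (m + L))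
poch⁻-snoc m L = ⊛-cong (≈-refl {poch⁻ m L}) (≈-trans (poch-mono-factor (- 1ℤ) m L) (one⊖negqpow (m + L)))

poch⁺-cons : ∀ m L → poch⁺ m (suc L) ≈ (one ⊖ qpow m) ⊛ poch⁺ (suc m) L
poch⁺-cons m L = ≈-trans (poch-mono-split 1ℤ m 1 L) (⊛-cong first (rest (ℕP.+-comm m 1)))
  where
  first : poch⁺ m 1 ≈ one ⊖ qpow m
  first = ≈-trans (⊛-identityˡ _) (≈-trans (poch-mono-factor 1ℤ m 0) (⊖-cong (≈-refl {one}) (qpow-cong (ℕP.+-identityʳ m))))
  rest : ∀ {a b} → a ≡ b → poch⁺ a L ≈ poch⁺ b L
  rest refl = ≈-refl

ConstTermOne-poch : ∀ a L → q^ 1 ∣ a → ConstTermOne (poch a L)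
ConstTermOne-poch a L 1∣a = ConstTermOne-prodPS L _ (λ i → ConstTermOne-one⊖ (q^∣-⊛ˡ (mono 1ℤ i) 1∣a))

ConstTermOne-poch⁺ : ∀ m L → 1 ≤ m → ConstTermOne (poch⁺ m L)
ConstTermOne-poch⁺ m L 1≤m = ConstTermOne-poch (qpow m) L (q^∣-weaken 1≤m (q^∣-mono 1ℤ m))

ConstTermOne-poch⁻ : ∀ m L → 1 ≤ m → ConstTermOne (poch⁻ m L)
ConstTermOne-poch⁻ m L 1≤m = ConstTermOne-poch (negqpow m) L (q^∣-weaken 1≤m (q^∣-mono (- 1ℤ) m))

qq : ℕ → PS
qq n = poch⁺ 1 n

mqq : ℕ → PS
mqq n = poch⁻ 1 n

ConstTermOne-qq : ∀ n → ConstTermOne (qq n)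
ConstTermOne-qq n = ConstTermOne-poch⁺ 1 n ℕP.≤-refl

ConstTermOne-mqq : ∀ n → ConstTermOne (mqq n)
ConstTermOne-mqq n = ConstTermOne-poch⁻ 1 n ℕP.≤-refl

triangular : ℕ → ℕ
triangular zero    = 0
triangular (suc n) = triangular n + suc n

triangular*2 : ∀ n → triangular n * 2 ≡ n * suc n
triangular*2 zero    = refl
triangular*2 (suc n) = begin
  (triangular n + suc n) * 2   ≡⟨ ℕP.*-distribʳ-+ 2 (triangular n) (suc n) ⟩
  triangular n * 2 + suc n * 2 ≡⟨ cong (_+ suc n * 2) (triangular*2 n) ⟩
  n * suc n + suc n * 2        ≡⟨ rearrange n ⟩
  suc n * suc (suc n)          ∎
  where
  open ≡-Reasoning
  rearrange : ∀ n → n * suc n + suc n * 2 ≡ suc n * suc (suc n)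
  rearrange = solve-∀

n[1+n]/2≡triangular : ∀ n → (n * suc n) ℕ./ 2 ≡ triangular n
n[1+n]/2≡triangular n = trans (cong (ℕ._/ 2) (sym (triangular*2 n))) (ℕD.m*n/n≡m (triangular n) 2)

sgn : ℕ → ℤ
sgn zero    = 1ℤ
sgn (suc k) = - sgn k

ConstTermOne-one⊖qpow : ∀ n → ConstTermOne (one ⊖ qpow (suc n))
ConstTermOne-one⊖qpow n = ConstTermOne-one⊖ (q^∣-weaken (s≤s z≤n) (q^∣-mono 1ℤ (suc n)))

ConstTermOne-one⊕qpow : ∀ n → ConstTermOne (one ⊕ qpow (suc n))
ConstTermOne-one⊕qpow n = ConstTermOne-one⊕ (q^∣-weaken (s≤s z≤n) (q^∣-mono 1ℤ (suc n)))

qpow-⊛-qpow : ∀ {a b c d} → a + b ≡ c + d → qpow a ⊛ qpow b ≈ qpow c ⊛ qpow d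
qpow-⊛-qpow {a} {b} {c} {d} a+b≡c+d =
  ≈-trans (≈-sym (qpow-+ a b)) (≈-trans (qpow-cong a+b≡c+d) (qpow-+ c d))

-- The geometric series 1/(1 + q^n) = Σ_k (-q^n)^k

altGeom : ℕ → ℕ → PS
altGeom n k = mono (sgn k) (n * k)

Summable-altGeom : ∀ n → Summable (altGeom (suc n))
Summable-altGeom n k = q^∣-weaken (ℕP.m≤n*m k (suc n)) (q^∣-mono (sgn k) (suc n * k))

qpow⊛altGeom : ∀ n k → qpow n ⊛ altGeom n k ≈ negPS (altGeom n (suc k))
qpow⊛altGeom n k N = begin
  (qpow n ⊛ altGeom n k) N          ≡⟨ mono-⊛-mono 1ℤ (sgn k) n (n * k) N ⟩
  mono (1ℤ ℤ.* sgn k) (n + n * k) N ≡⟨ cong₂ (λ c e → mono c e N) (ℤP.*-identityˡ (sgn k)) (sym (ℕP.*-suc n k)) ⟩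
  mono (sgn k) (n * suc k) N        ≡⟨ ℤP.neg-involutive _ ⟨
  - - mono (sgn k) (n * suc k) N    ≡⟨ cong -_ (mono-neg (sgn k) (n * suc k) N) ⟨
  negPS (altGeom n (suc k)) N       ∎
  where open ≡-Reasoning

inv-one⊕qpow : ∀ n → inv (one ⊕ qpow (suc n)) ≈ Σ∞ (altGeom (suc n))
inv-one⊕qpow n = ≈-sym (inv-unique (ConstTermOne-one⊕qpow n) (begin
  Σ∞ G ⊛ (one ⊕ x)           ≈⟨ ⊛-comm (Σ∞ G) (one ⊕ x) ⟩
  (one ⊕ x) ⊛ Σ∞ G           ≈⟨ ⊛-distribˡ-Σ∞ (one ⊕ x) G (Summable-altGeom n) ⟩
  Σ∞ (λ k → (one ⊕ x) ⊛ G k) ≈⟨ Σ∞-cong telescoping ⟩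
  Σ∞ (λ k → G k ⊖ G (suc k)) ≈⟨ Σ∞-telescope G (Summable-altGeom n) ⟩
  G 0                        ≈⟨ qpow-cong (ℕP.*-zeroʳ (suc n)) ⟩
  one                        ∎))
  where
  open ≈-Reasoning
  x = qpow (suc n)
  G = altGeom (suc n)
  telescoping : ∀ k → (one ⊕ x) ⊛ G k ≈ G k ⊖ G (suc k)
  telescoping k = ≈-trans (solve 2 (λ x g → (con 1ℤ :+ x) :* g := g :+ x :* g) ≈-refl x (G k))
                          (⊕-cong (≈-refl {G k}) (qpow⊛altGeom (suc n) k))

-- The q-binomial series Σ_j (-q;q)_j/(q;q)_j z^j at z = q^w

inv-qq-suc : ∀ j → inv (qq (suc j)) ≈ inv (qq j) ⊛ inv (one ⊖ qpow (suc j))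
inv-qq-suc j = ≈-trans (inv-cong (poch⁺-snoc 1 j))
  (inv-⊛ (qq j) (one ⊖ qpow (suc j)) (ConstTermOne-qq j) (ConstTermOne-one⊖qpow j))

inv-mqq-suc : ∀ j → inv (mqq (suc j)) ≈ inv (mqq j) ⊛ inv (one ⊕ qpow (suc j))
inv-mqq-suc j = ≈-trans (inv-cong (poch⁻-snoc 1 j))
  (inv-⊛ (mqq j) (one ⊕ qpow (suc j)) (ConstTermOne-mqq j) (ConstTermOne-one⊕qpow j))

mqq/qq : ℕ → PS
mqq/qq j = mqq j ⊛ inv (qq j)

mqq/qq-rec : ∀ j → mqq/qq (suc j) ⊛ (one ⊖ qpow (suc j)) ≈ mqq/qq j ⊛ (one ⊕ qpow (suc j))
mqq/qq-rec j = begin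
  (mqq (suc j) ⊛ inv (qq (suc j))) ⊛ U
    ≈⟨ ⊛-cong (⊛-cong (poch⁻-snoc 1 j) (inv-qq-suc j)) (≈-refl {U}) ⟩
  ((mqq j ⊛ P) ⊛ (inv (qq j) ⊛ inv U)) ⊛ U
    ≈⟨ solve 5 (λ b p ia iu u → ((b :* p) :* (ia :* iu)) :* u := ((b :* ia) :* p) :* (iu :* u))
         ≈-refl (mqq j) P (inv (qq j)) (inv U) U ⟩
  (mqq/qq j ⊛ P) ⊛ (inv U ⊛ U)
    ≈⟨ ⊛-cong (≈-refl {mqq/qq j ⊛ P}) (inv-inverseˡ U (ConstTermOne-one⊖qpow j)) ⟩
  (mqq/qq j ⊛ P) ⊛ one
    ≈⟨ ⊛-identityʳ _ ⟩
  mqq/qq j ⊛ P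
    ∎
  where
  open ≈-Reasoning
  U = one ⊖ qpow (suc j)
  P = one ⊕ qpow (suc j)

qbinTerm : ℕ → ℕ → PS
qbinTerm w j = mqq/qq j ⊛ qpow (w * j)

qbin : ℕ → PS
qbin w = Σ∞ (qbinTerm w)

Summable-qbinTerm : ∀ w → Summable (qbinTerm (suc w))
Summable-qbinTerm w j = q^∣-weaken (ℕP.m≤n*m j (suc w)) (q^∣-⊛ʳ (mqq/qq j) (q^∣-mono 1ℤ (suc w * j)))

qbinTerm-zero : ∀ w → qbinTerm w 0 ≈ one
qbinTerm-zero w = begin
  (one ⊛ inv one) ⊛ qpow (w * 0) ≈⟨ ⊛-cong (≈-trans (⊛-identityˡ (inv one)) inv-one) (qpow-cong (ℕP.*-zeroʳ w)) ⟩
  one ⊛ one                      ≈⟨ ⊛-identityˡ one ⟩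
  one                            ∎
  where open ≈-Reasoning

qbinTerm-step : ∀ w j → qbinTerm w (suc j) ⊖ qbinTerm (suc w) (suc j) ≈
                        qpow w ⊛ qbinTerm w j ⊕ qpow (suc w) ⊛ qbinTerm (suc w) j
qbinTerm-step w j = begin
  c′ ⊛ qpow (w * suc j) ⊖ c′ ⊛ qpow (suc w * suc j)
    ≈⟨ ⊖-cong (≈-refl {c′ ⊛ qpow (w * suc j)}) (⊛-cong (≈-refl {c′}) (qpow-+ (suc j) (w * suc j))) ⟩
  c′ ⊛ qpow (w * suc j) ⊖ c′ ⊛ (qpow (suc j) ⊛ qpow (w * suc j))
    ≈⟨ solve 3 (λ c′ x y → c′ :* y :- c′ :* (x :* y) := (c′ :* (con 1ℤ :- x)) :* y)
         ≈-refl c′ (qpow (suc j)) (qpow (w * suc j)) ⟩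
  (c′ ⊛ (one ⊖ qpow (suc j))) ⊛ qpow (w * suc j)
    ≈⟨ ⊛-cong (mqq/qq-rec j) (≈-refl {qpow (w * suc j)}) ⟩
  (c ⊛ (one ⊕ qpow (suc j))) ⊛ qpow (w * suc j)
    ≈⟨ solve 3 (λ c x y → (c :* (con 1ℤ :+ x)) :* y := c :* y :+ c :* (x :* y))
         ≈-refl c (qpow (suc j)) (qpow (w * suc j)) ⟩
  c ⊛ qpow (w * suc j) ⊕ c ⊛ (qpow (suc j) ⊛ qpow (w * suc j))
    ≈⟨ ⊕-cong (⊛-cong (≈-refl {c}) (≈-trans (qpow-cong (ℕP.*-suc w j)) (qpow-+ w (w * j))))
              (⊛-cong (≈-refl {c}) (qpow-⊛-qpow (exponents w j))) ⟩
  c ⊛ (qpow w ⊛ qpow (w * j)) ⊕ c ⊛ (qpow (suc w) ⊛ qpow (suc w * j))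
    ≈⟨ solve 5 (λ c a b a′ b′ → c :* (a :* b) :+ c :* (a′ :* b′) := a :* (c :* b) :+ a′ :* (c :* b′))
         ≈-refl c (qpow w) (qpow (w * j)) (qpow (suc w)) (qpow (suc w * j)) ⟩
  qpow w ⊛ qbinTerm w j ⊕ qpow (suc w) ⊛ qbinTerm (suc w) j
    ∎
  where
  open ≈-Reasoning
  c = mqq/qq j
  c′ = mqq/qq (suc j)
  exponents : ∀ w j → suc j + w * suc j ≡ suc w + suc w * j
  exponents = solve-∀

qbin-difference : ∀ w → qbin (suc w) ⊖ qbin (suc (suc w)) ≈ qpow (suc w) ⊛ qbin (suc w) ⊕ qpow (suc (suc w)) ⊛ qbin (suc (suc w))
qbin-difference w = begin
  qbin (suc w) ⊖ qbin (suc (suc w))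
    ≈⟨ ≈-sym (Σ∞-⊖ (qbinTerm (suc w)) (qbinTerm (suc (suc w)))) ⟩
  Σ∞ D
    ≈⟨ Σ∞-from-1 D D-summable D₀≈0 ⟩
  Σ∞ (λ j → D (suc j))
    ≈⟨ Σ∞-cong (qbinTerm-step (suc w)) ⟩
  Σ∞ (λ j → qpow (suc w) ⊛ qbinTerm (suc w) j ⊕ qpow (suc (suc w)) ⊛ qbinTerm (suc (suc w)) j)
    ≈⟨ Σ∞-⊕ _ _ ⟩
  Σ∞ (λ j → qpow (suc w) ⊛ qbinTerm (suc w) j) ⊕ Σ∞ (λ j → qpow (suc (suc w)) ⊛ qbinTerm (suc (suc w)) j)
    ≈⟨ ⊕-cong (≈-sym (⊛-distribˡ-Σ∞ (qpow (suc w)) (qbinTerm (suc w)) (Summable-qbinTerm w)))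
              (≈-sym (⊛-distribˡ-Σ∞ (qpow (suc (suc w))) (qbinTerm (suc (suc w))) (Summable-qbinTerm (suc w)))) ⟩
  qpow (suc w) ⊛ qbin (suc w) ⊕ qpow (suc (suc w)) ⊛ qbin (suc (suc w))
    ∎
  where
  open ≈-Reasoning
  D : ℕ → PS
  D j = qbinTerm (suc w) j ⊖ qbinTerm (suc (suc w)) j
  D-summable : Summable D
  D-summable j = q^∣-⊖ (Summable-qbinTerm w j) (Summable-qbinTerm (suc w) j)
  D₀≈0 : D 0 ≈ zeroPS
  D₀≈0 N = trans (cong₂ ℤ._-_ (qbinTerm-zero (suc w) N) (qbinTerm-zero (suc (suc w)) N)) (ℤP.+-inverseʳ (one N))

qbin-rec : ∀ w → (one ⊖ qpow (suc w)) ⊛ qbin (suc w) ≈ (one ⊕ qpow (suc (suc w))) ⊛ qbin (suc (suc w))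
qbin-rec w = begin
  (one ⊖ a) ⊛ x
    ≈⟨ solve 3 (λ a x y → (con 1ℤ :- a) :* x := (x :- y) :- a :* x :+ y) ≈-refl a x y ⟩
  (x ⊖ y) ⊖ a ⊛ x ⊕ y
    ≈⟨ ⊕-cong (⊖-cong (qbin-difference w) (≈-refl {a ⊛ x})) (≈-refl {y}) ⟩
  (a ⊛ x ⊕ a′ ⊛ y) ⊖ a ⊛ x ⊕ y
    ≈⟨ solve 4 (λ a a′ x y → (a :* x :+ a′ :* y) :- a :* x :+ y := (con 1ℤ :+ a′) :* y) ≈-refl a a′ x y ⟩
  (one ⊕ a′) ⊛ y
    ∎
  where
  open ≈-Reasoning
  a = qpow (suc w)
  a′ = qpow (suc (suc w))
  x = qbin (suc w)
  y = qbin (suc (suc w))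

-- ρ = (1 + q) F(q) = (-q;q)_∞/(q;q)_∞ by the q-binomial theorem.
ρ : PS
ρ = qbin 1 ⊛ mqq 1

qbin-closed : ∀ k → qbin (suc k) ⊛ mqq (suc k) ≈ ρ ⊛ qq k
qbin-closed zero    = ≈-sym (⊛-identityʳ ρ)
qbin-closed (suc k) = begin
  qbin (2+k) ⊛ mqq (2+k)           ≈⟨ ⊛-cong (≈-refl {qbin (2+k)}) (poch⁻-snoc 1 (suc k)) ⟩
  qbin (2+k) ⊛ (mqq (suc k) ⊛ P)   ≈⟨ solve 3 (λ g b p → g :* (b :* p) := (p :* g) :* b) ≈-refl (qbin (2+k)) (mqq (suc k)) P ⟩
  (P ⊛ qbin (2+k)) ⊛ mqq (suc k)   ≈⟨ ⊛-cong (≈-sym (qbin-rec k)) (≈-refl {mqq (suc k)}) ⟩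
  (U ⊛ qbin (suc k)) ⊛ mqq (suc k) ≈⟨ ⊛-assoc U (qbin (suc k)) (mqq (suc k)) ⟩
  U ⊛ (qbin (suc k) ⊛ mqq (suc k)) ≈⟨ ⊛-cong (≈-refl {U}) (qbin-closed k) ⟩
  U ⊛ (ρ ⊛ qq k)                   ≈⟨ solve 3 (λ u r a → u :* (r :* a) := r :* (a :* u)) ≈-refl U ρ (qq k) ⟩
  ρ ⊛ (qq k ⊛ U)                   ≈⟨ ⊛-cong (≈-refl {ρ}) (≈-sym (poch⁺-snoc 1 k)) ⟩
  ρ ⊛ qq (suc k)                   ∎
  where
  open ≈-Reasoning
  2+k = suc (suc k)
  P = one ⊕ qpow (2+k)
  U = one ⊖ qpow (suc k)

qbin-closed-form : ∀ k → qbin (suc k) ≈ ρ ⊛ qq k ⊛ inv (mqq (suc k))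
qbin-closed-form k = ⊛-cancelʳ {mqq (suc k)} {qbin (suc k)} (ConstTermOne-mqq (suc k)) (begin
  qbin (suc k) ⊛ mqq (suc k)                   ≈⟨ qbin-closed k ⟩
  ρ ⊛ qq k                                     ≈⟨ ⊛-identityʳ (ρ ⊛ qq k) ⟨
  ρ ⊛ qq k ⊛ one                               ≈⟨ ⊛-cong (≈-refl {ρ ⊛ qq k}) (inv-inverseˡ (mqq (suc k)) (ConstTermOne-mqq (suc k))) ⟨
  ρ ⊛ qq k ⊛ (inv (mqq (suc k)) ⊛ mqq (suc k)) ≈⟨ ⊛-assoc (ρ ⊛ qq k) (inv (mqq (suc k))) (mqq (suc k)) ⟨
  ρ ⊛ qq k ⊛ inv (mqq (suc k)) ⊛ mqq (suc k)   ∎)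
  where open ≈-Reasoning

qbin-≈[≤]-one : ∀ M → qbin (suc M) ≈[≤ M ] one
qbin-≈[≤]-one M = q^∣-⊖⇒≈[≤] M (q^∣-≈ (≈-sym qbin-1≈tail) (q^∣-Σ∞ _ tail-divisible))
  where
  F = qbinTerm (suc M)
  qbin-1≈tail : qbin (suc M) ⊖ one ≈ Σ∞ (λ j → F (suc j))
  qbin-1≈tail = ≈-trans (⊖-cong (≈-trans (Σ∞-first F (Summable-qbinTerm M)) (⊕-cong (qbinTerm-zero (suc M)) ≈-refl)) ≈-refl)
                        (solve 2 (λ o x → (o :+ x) :- o := x) ≈-refl one (Σ∞ (λ j → F (suc j))))
  tail-divisible : ∀ j → q^ suc M ∣ F (suc j)
  tail-divisible j = q^∣-weaken (ℕP.m≤m*n (suc M) (suc j)) (q^∣-⊛ʳ (mqq/qq (suc j)) (q^∣-mono 1ℤ (suc M * suc j)))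

ρ⊛qq-≈[≤] : ∀ M → ρ ⊛ qq M ≈[≤ M ] mqq M
ρ⊛qq-≈[≤] M =
  ≈[≤]-trans (≈⇒≈[≤] M (≈-sym (qbin-closed M)))
  (≈[≤]-trans (≈[≤]-⊛ (qbin-≈[≤]-one M) (≈⇒≈[≤] M (poch⁻-snoc 1 M)))
  (≈[≤]-trans (≈⇒≈[≤] M (⊛-identityˡ (mqq M ⊛ (one ⊕ qpow (suc M)))))
  (≈[≤]-trans (≈[≤]-⊛ (≈[≤]-refl {mqq M} M) one⊕q^[1+M]≈1) (≈⇒≈[≤] M (⊛-identityʳ (mqq M))))))
  where
  one⊕q^[1+M]≈1 : one ⊕ qpow (suc M) ≈[≤ M ] one
  one⊕q^[1+M]≈1 k k≤M = trans (cong (ℤ._+_ (one k)) (q^∣-mono 1ℤ (suc M) k (s≤s k≤M))) (ℤP.+-identityʳ (one k))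

poch-tail-≈[≤]-one : ∀ a N i → suc N ≤ i → one ⊖ a ⊛ mono 1ℤ i ≈[≤ N ] one
poch-tail-≈[≤]-one a N i N<i = one⊖-≈[≤] N (q^∣-⊛ʳ a (q^∣-weaken N<i (q^∣-mono 1ℤ i)))

-- Up to any given degree the infinite products may be replaced by finite ones.
infinite-poch-ratio : ∀ m {R S} → Converges (poch (negqpow (suc m))) R → Converges (poch (qpow (suc m))) S →
                      R ⊛ inv S ≈ ρ ⊛ qq m ⊛ inv (mqq m)
infinite-poch-ratio m {R} {S} R-limit S-limit = ≈[≤]⇒≈ λ N →
  let K = suc N
      R≈ = limit-≈[≤]-prodPS _ R N K R-limit (poch-tail-≈[≤]-one (negqpow (suc m)) N)
      S≈ = limit-≈[≤]-prodPS _ S N K S-limit (poch-tail-≈[≤]-one (qpow (suc m)) N)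
      U = poch⁺ (suc m) K ⊛ mqq m
      U₀≡1 = ConstTermOne-⊛ {poch⁺ (suc m) K} {mqq m} (ConstTermOne-poch⁺ (suc m) K (s≤s z≤n)) (ConstTermOne-mqq m)
  in ≈[≤]-trans (≈[≤]-⊛ R≈ (inv-≈[≤] S≈))
     (⊛-cancelʳ-≈[≤] {U} U₀≡1
       (≈[≤]-weaken (ℕP.≤-trans (ℕP.n≤1+n N) (ℕP.m≤n+m K m))
         (≈[≤]-trans (≈⇒≈[≤] (m + K) (finite-lhs K))
         (≈[≤]-trans (≈[≤]-sym (ρ⊛qq-≈[≤] (m + K)))
                     (≈⇒≈[≤] (m + K) (≈-sym (finite-rhs K)))))))
  where
  open ≈-Reasoning
  finite-lhs : ∀ K → (poch⁻ (suc m) K ⊛ inv (poch⁺ (suc m) K)) ⊛ (poch⁺ (suc m) K ⊛ mqq m) ≈ mqq (m + K)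
  finite-lhs K = begin
    (p ⊛ inv s) ⊛ (s ⊛ mqq m) ≈⟨ solve 4 (λ p is s b → (p :* is) :* (s :* b) := (b :* p) :* (is :* s)) ≈-refl p (inv s) s (mqq m) ⟩
    (mqq m ⊛ p) ⊛ (inv s ⊛ s) ≈⟨ ⊛-cong (≈-refl {mqq m ⊛ p}) (inv-inverseˡ s (ConstTermOne-poch⁺ (suc m) K (s≤s z≤n))) ⟩
    (mqq m ⊛ p) ⊛ one         ≈⟨ ⊛-identityʳ (mqq m ⊛ p) ⟩
    mqq m ⊛ p                 ≈⟨ poch-mono-split (- 1ℤ) 1 m K ⟨
    mqq (m + K)               ∎
    where
    p = poch⁻ (suc m) K
    s = poch⁺ (suc m) K
  finite-rhs : ∀ K → (ρ ⊛ qq m ⊛ inv (mqq m)) ⊛ (poch⁺ (suc m) K ⊛ mqq m) ≈ ρ ⊛ qq (m + K)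
  finite-rhs K = begin
    (ρ ⊛ qq m ⊛ inv (mqq m)) ⊛ (s ⊛ mqq m)
      ≈⟨ solve 5 (λ r a ib s b → (r :* a :* ib) :* (s :* b) := (r :* (a :* s)) :* (ib :* b)) ≈-refl ρ (qq m) (inv (mqq m)) s (mqq m) ⟩
    (ρ ⊛ (qq m ⊛ s)) ⊛ (inv (mqq m) ⊛ mqq m)
      ≈⟨ ⊛-cong (⊛-cong (≈-refl {ρ}) (≈-sym (poch-mono-split 1ℤ 1 m K))) (inv-inverseˡ (mqq m) (ConstTermOne-mqq m)) ⟩
    (ρ ⊛ qq (m + K)) ⊛ one
      ≈⟨ ⊛-identityʳ (ρ ⊛ qq (m + K)) ⟩
    ρ ⊛ qq (m + K)
      ∎
    where s = poch⁺ (suc m) K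

-- The series 1/(-q;q)_j = Σ_i (-q)^i (q^j;q)_i/(q;q)_i

recipTerm : ℕ → ℕ → PS
recipTerm j i = mono (sgn i) i ⊛ poch⁺ j i ⊛ inv (qq i)

recip : ℕ → PS
recip j = Σ∞ (recipTerm j)

Summable-recipTerm : ∀ j → Summable (recipTerm j)
Summable-recipTerm j i = q^∣-⊛ˡ (inv (qq i)) (q^∣-⊛ˡ (poch⁺ j i) (q^∣-mono (sgn i) i))

inv-qq-suc⊛factor : ∀ i → inv (qq (suc i)) ⊛ (one ⊖ qpow (suc i)) ≈ inv (qq i)
inv-qq-suc⊛factor i = begin
  inv (qq (suc i)) ⊛ U     ≈⟨ ⊛-cong (inv-qq-suc i) (≈-refl {U}) ⟩
  (inv (qq i) ⊛ inv U) ⊛ U ≈⟨ ⊛-assoc (inv (qq i)) (inv U) U ⟩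
  inv (qq i) ⊛ (inv U ⊛ U) ≈⟨ ⊛-cong (≈-refl {inv (qq i)}) (inv-inverseˡ U (ConstTermOne-one⊖qpow i)) ⟩
  inv (qq i) ⊛ one         ≈⟨ ⊛-identityʳ (inv (qq i)) ⟩
  inv (qq i)               ∎
  where
  open ≈-Reasoning
  U = one ⊖ qpow (suc i)

recipTerm-step : ∀ j i → recipTerm j (suc i) ⊖ recipTerm (suc j) (suc i) ≈ qpow (suc j) ⊛ recipTerm (suc j) i
recipTerm-step j i = begin
  m′ ⊛ poch⁺ j (suc i) ⊛ I ⊖ m′ ⊛ poch⁺ (suc j) (suc i) ⊛ I
    ≈⟨ ⊖-cong (⊛-cong (⊛-cong m′≈ (poch⁺-cons j i)) (≈-refl {I}))
              (⊛-cong (⊛-cong m′≈ (≈-trans (poch⁺-snoc (suc j) i) (⊛-cong (≈-refl {y}) (⊖-cong (≈-refl {one}) q^[1+j+i]≈)))) (≈-refl {I})) ⟩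
  negPS (s ⊛ q) ⊛ ((one ⊖ x) ⊛ y) ⊛ I ⊖ negPS (s ⊛ q) ⊛ (y ⊛ (one ⊖ x ⊛ w)) ⊛ I
    ≈⟨ solve 6 (λ s q x y w I → (:- (s :* q)) :* ((con 1ℤ :- x) :* y) :* I :- (:- (s :* q)) :* (y :* (con 1ℤ :- x :* w)) :* I
                := (x :* q) :* (s :* y :* (I :* (con 1ℤ :- w)))) ≈-refl s q x y w I ⟩
  (x ⊛ q) ⊛ (s ⊛ y ⊛ (I ⊛ (one ⊖ w)))
    ≈⟨ ⊛-cong (≈-sym (mono-suc 1ℤ j)) (⊛-cong (≈-refl {s ⊛ y}) (inv-qq-suc⊛factor i)) ⟩
  qpow (suc j) ⊛ recipTerm (suc j) i
    ∎
  where
  open ≈-Reasoning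
  s = mono (sgn i) i
  q = qpow 1
  x = qpow j
  y = poch⁺ (suc j) i
  w = qpow (suc i)
  I = inv (qq (suc i))
  m′ = mono (sgn (suc i)) (suc i)
  m′≈ : m′ ≈ negPS (s ⊛ q)
  m′≈ = ≈-trans (mono-neg (sgn i) (suc i)) (negPS-cong (mono-suc (sgn i) i))
  q^[1+j+i]≈ : qpow (suc j + i) ≈ x ⊛ w
  q^[1+j+i]≈ = ≈-trans (qpow-cong (sym (ℕP.+-suc j i))) (qpow-+ j (suc i))

recip-rec : ∀ j → recip j ≈ (one ⊕ qpow (suc j)) ⊛ recip (suc j)
recip-rec j = begin
  recip j                                      ≈⟨ solve 2 (λ x y → x := (x :- y) :+ y) ≈-refl (recip j) (recip (suc j)) ⟩
  (recip j ⊖ recip (suc j)) ⊕ recip (suc j)    ≈⟨ ⊕-cong difference (≈-refl {recip (suc j)}) ⟩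
  qpow (suc j) ⊛ recip (suc j) ⊕ recip (suc j) ≈⟨ solve 2 (λ a y → a :* y :+ y := (con 1ℤ :+ a) :* y) ≈-refl (qpow (suc j)) (recip (suc j)) ⟩
  (one ⊕ qpow (suc j)) ⊛ recip (suc j)         ∎
  where
  open ≈-Reasoning
  D : ℕ → PS
  D i = recipTerm j i ⊖ recipTerm (suc j) i
  difference : recip j ⊖ recip (suc j) ≈ qpow (suc j) ⊛ recip (suc j)
  difference = begin
    recip j ⊖ recip (suc j)
      ≈⟨ Σ∞-⊖ (recipTerm j) (recipTerm (suc j)) ⟨
    Σ∞ D
      ≈⟨ Σ∞-from-1 D (λ i → q^∣-⊖ (Summable-recipTerm j i) (Summable-recipTerm (suc j) i))
                     (λ N → ℤP.+-inverseʳ (recipTerm j 0 N)) ⟩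
    Σ∞ (λ i → D (suc i))
      ≈⟨ Σ∞-cong (recipTerm-step j) ⟩
    Σ∞ (λ i → qpow (suc j) ⊛ recipTerm (suc j) i)
      ≈⟨ ⊛-distribˡ-Σ∞ (qpow (suc j)) (recipTerm (suc j)) (Summable-recipTerm (suc j)) ⟨
    qpow (suc j) ⊛ recip (suc j)
      ∎

recip-zero : recip 0 ≈ one
recip-zero = begin
  recip 0
    ≈⟨ Σ∞-first (recipTerm 0) (Summable-recipTerm 0) ⟩
  recipTerm 0 0 ⊕ Σ∞ (λ i → recipTerm 0 (suc i))
    ≈⟨ ⊕-cong (≈-trans (⊛-cong (⊛-identityˡ one) (≈-refl {inv one})) (≈-trans (⊛-identityˡ (inv one)) inv-one))
              (λ N → sum-zero (suc N) (λ i _ → higher-terms-vanish i N)) ⟩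
  one ⊕ zeroPS
    ≈⟨ (λ N → ℤP.+-identityʳ (one N)) ⟩
  one
    ∎
  where
  open ≈-Reasoning
  higher-terms-vanish : ∀ i → recipTerm 0 (suc i) ≈ zeroPS
  higher-terms-vanish i = begin
    mono (sgn (suc i)) (suc i) ⊛ poch⁺ 0 (suc i) ⊛ inv (qq (suc i))
      ≈⟨ ⊛-cong (⊛-cong (≈-refl {mono (sgn (suc i)) (suc i)}) (poch⁺-cons 0 i)) (≈-refl {inv (qq (suc i))}) ⟩
    mono (sgn (suc i)) (suc i) ⊛ ((one ⊖ one) ⊛ poch⁺ 1 i) ⊛ inv (qq (suc i))
      ≈⟨ solve 4 (λ m p iq o → m :* ((o :- o) :* p) :* iq := con 0ℤ) ≈-refl (mono (sgn (suc i)) (suc i)) (poch⁺ 1 i) (inv (qq (suc i))) one ⟩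
    mono 0ℤ 0
      ≈⟨ mono-zero 0 ⟩
    zeroPS
      ∎

recip⊛mqq : ∀ j → recip j ⊛ mqq j ≈ one
recip⊛mqq zero    = ≈-trans (⊛-identityʳ (recip 0)) recip-zero
recip⊛mqq (suc j) = begin
  recip (suc j) ⊛ mqq (suc j) ≈⟨ ⊛-cong (≈-refl {recip (suc j)}) (poch⁻-snoc 1 j) ⟩
  recip (suc j) ⊛ (mqq j ⊛ P) ≈⟨ solve 3 (λ v b p → v :* (b :* p) := (p :* v) :* b) ≈-refl (recip (suc j)) (mqq j) P ⟩
  (P ⊛ recip (suc j)) ⊛ mqq j ≈⟨ ⊛-cong (≈-sym (recip-rec j)) (≈-refl {mqq j}) ⟩
  recip j ⊛ mqq j             ≈⟨ recip⊛mqq j ⟩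
  one                         ∎
  where
  open ≈-Reasoning
  P = one ⊕ qpow (suc j)

inv-mqq : ∀ j → inv (mqq j) ≈ recip j
inv-mqq j = ≈-sym (inv-unique (ConstTermOne-mqq j) (recip⊛mqq j))

-- Two solutions of x_k = q^{k+1} - (1 - q^{k+1}) x_{k+1}

aTerm : ℕ → ℕ → PS
aTerm k s = mono (sgn s) (suc k + s) ⊛ poch⁺ (suc k) s

aSeries : ℕ → PS
aSeries k = Σ∞ (aTerm k)

q^∣-aTerm : ∀ k s → q^ suc k + s ∣ aTerm k s
q^∣-aTerm k s = q^∣-⊛ˡ (poch⁺ (suc k) s) (q^∣-mono (sgn s) (suc k + s))

Summable-aTerm : ∀ k → Summable (aTerm k)
Summable-aTerm k s = q^∣-weaken (ℕP.m≤n+m s (suc k)) (q^∣-aTerm k s)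

q^∣-aSeries : ∀ k → q^ k ∣ aSeries k
q^∣-aSeries k = q^∣-Σ∞ (aTerm k) (λ s → q^∣-weaken (ℕP.≤-trans (ℕP.n≤1+n k) (ℕP.m≤m+n (suc k) s)) (q^∣-aTerm k s))

aSeries-rec : ∀ k → aSeries k ≈ qpow (suc k) ⊕ negPS ((one ⊖ qpow (suc k)) ⊛ aSeries (suc k))
aSeries-rec k = begin
  aSeries k
    ≈⟨ Σ∞-first (aTerm k) (Summable-aTerm k) ⟩
  aTerm k 0 ⊕ Σ∞ (λ s → aTerm k (suc s))
    ≈⟨ ⊕-cong first (Σ∞-cong rest) ⟩
  qpow (suc k) ⊕ Σ∞ (λ s → negPS (U ⊛ aTerm (suc k) s))
    ≈⟨ ⊕-cong (≈-refl {qpow (suc k)}) (≈-trans (Σ∞-negPS (λ s → U ⊛ aTerm (suc k) s))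
         (negPS-cong (≈-sym (⊛-distribˡ-Σ∞ U (aTerm (suc k)) (Summable-aTerm (suc k)))))) ⟩
  qpow (suc k) ⊕ negPS (U ⊛ aSeries (suc k))
    ∎
  where
  open ≈-Reasoning
  U = one ⊖ qpow (suc k)
  first : aTerm k 0 ≈ qpow (suc k)
  first = ≈-trans (⊛-identityʳ (mono 1ℤ (suc k + 0))) (qpow-cong (ℕP.+-identityʳ (suc k)))
  rest : ∀ s → aTerm k (suc s) ≈ negPS (U ⊛ aTerm (suc k) s)
  rest s = begin
    mono (- sgn s) (suc k + suc s) ⊛ poch⁺ (suc k) (suc s)
      ≈⟨ ⊛-cong (≈-trans (mono-neg (sgn s) (suc k + suc s)) (λ N → cong (λ e → - mono (sgn s) e N) (ℕP.+-suc (suc k) s)))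
                (poch⁺-cons (suc k) s) ⟩
    negPS m ⊛ (U ⊛ y)
      ≈⟨ solve 3 (λ m u y → (:- m) :* (u :* y) := :- (u :* (m :* y))) ≈-refl m U y ⟩
    negPS (U ⊛ aTerm (suc k) s)
      ∎
    where
    m = mono (sgn s) (suc (suc k) + s)
    y = poch⁺ (suc (suc k)) s

β : ℕ → PS
β m = qpow (triangular m) ⊛ inv (mqq m)

β-rec : ∀ n → β (suc n) ⊛ (one ⊕ qpow (suc n)) ≈ qpow (suc n) ⊛ β n
β-rec n = begin
  (qpow (triangular n + suc n) ⊛ inv (mqq (suc n))) ⊛ P
    ≈⟨ ⊛-cong (⊛-cong (qpow-+ (triangular n) (suc n)) (inv-mqq-suc n)) (≈-refl {P}) ⟩
  ((qpow (triangular n) ⊛ x) ⊛ (inv (mqq n) ⊛ inv P)) ⊛ P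
    ≈⟨ solve 5 (λ t x ib ip p → ((t :* x) :* (ib :* ip)) :* p := (x :* (t :* ib)) :* (ip :* p))
         ≈-refl (qpow (triangular n)) x (inv (mqq n)) (inv P) P ⟩
  (x ⊛ β n) ⊛ (inv P ⊛ P)
    ≈⟨ ⊛-cong (≈-refl {x ⊛ β n}) (inv-inverseˡ P (ConstTermOne-one⊕qpow n)) ⟩
  (x ⊛ β n) ⊛ one
    ≈⟨ ⊛-identityʳ (x ⊛ β n) ⟩
  x ⊛ β n
    ∎
  where
  open ≈-Reasoning
  x = qpow (suc n)
  P = one ⊕ x

φTerm : ℕ → ℕ → PS
φTerm k n = β (suc n) ⊛ qpow (suc n * k)

φSeries : ℕ → PS
φSeries k = Σ∞ (φTerm k)

n≤triangular[1+n] : ∀ n → n ≤ triangular (suc n)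
n≤triangular[1+n] n = ℕP.≤-trans (ℕP.n≤1+n n) (ℕP.m≤n+m (suc n) (triangular n))

Summable-φTerm : ∀ k → Summable (φTerm k)
Summable-φTerm k n = q^∣-weaken (n≤triangular[1+n] n)
  (q^∣-⊛ˡ (qpow (suc n * k)) (q^∣-⊛ˡ (inv (mqq (suc n))) (q^∣-mono 1ℤ (triangular (suc n)))))

q^∣-φSeries : ∀ k → q^ k ∣ φSeries k
q^∣-φSeries k = q^∣-Σ∞ (φTerm k) (λ n → q^∣-weaken (ℕP.m≤n*m k (suc n)) (q^∣-⊛ʳ (β (suc n)) (q^∣-mono 1ℤ (suc n * k))))

φSeries-rec : ∀ k → φSeries k ≈ qpow (suc k) ⊕ negPS ((one ⊖ qpow (suc k)) ⊛ φSeries (suc k))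
φSeries-rec k = begin
  φSeries k
    ≈⟨ solve 2 (λ x y → x := (x :+ y) :- y) ≈-refl (φSeries k) (φSeries (suc k)) ⟩
  (φSeries k ⊕ φSeries (suc k)) ⊖ φSeries (suc k)
    ≈⟨ ⊖-cong consecutive-sum (≈-refl {φSeries (suc k)}) ⟩
  (x ⊕ x ⊛ φSeries (suc k)) ⊖ φSeries (suc k)
    ≈⟨ solve 2 (λ x f → (x :+ x :* f) :- f := x :+ (:- ((con 1ℤ :- x) :* f))) ≈-refl x (φSeries (suc k)) ⟩
  x ⊕ negPS ((one ⊖ x) ⊛ φSeries (suc k))
    ∎
  where
  open ≈-Reasoning
  x = qpow (suc k)
  Ψ : ℕ → PS
  Ψ n = β n ⊛ qpow (suc n * suc k)
  Ψ-summable : Summable Ψ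
  Ψ-summable n = q^∣-weaken (ℕP.≤-trans (ℕP.n≤1+n n) (ℕP.m≤m*n (suc n) (suc k)))
                            (q^∣-⊛ʳ (β n) (q^∣-mono 1ℤ (suc n * suc k)))
  q^[1+n][1+k]≈ : ∀ n → qpow (suc n * suc k) ≈ qpow (suc n) ⊛ qpow (suc n * k)
  q^[1+n][1+k]≈ n = ≈-trans (qpow-cong (ℕP.*-suc (suc n) k)) (qpow-+ (suc n) (suc n * k))
  pair : ∀ n → φTerm k n ⊕ φTerm (suc k) n ≈ Ψ n
  pair n = begin
    b′ ⊛ e ⊕ b′ ⊛ qpow (suc n * suc k) ≈⟨ ⊕-cong (≈-refl {b′ ⊛ e}) (⊛-cong (≈-refl {b′}) (q^[1+n][1+k]≈ n)) ⟩
    b′ ⊛ e ⊕ b′ ⊛ (y ⊛ e)              ≈⟨ solve 3 (λ b e y → b :* e :+ b :* (y :* e) := (b :* (con 1ℤ :+ y)) :* e) ≈-refl b′ e y ⟩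
    (b′ ⊛ (one ⊕ y)) ⊛ e               ≈⟨ ⊛-cong (β-rec n) (≈-refl {e}) ⟩
    (y ⊛ β n) ⊛ e                      ≈⟨ solve 3 (λ y b e → (y :* b) :* e := b :* (y :* e)) ≈-refl y (β n) e ⟩
    β n ⊛ (y ⊛ e)                      ≈⟨ ⊛-cong (≈-refl {β n}) (≈-sym (q^[1+n][1+k]≈ n)) ⟩
    Ψ n                                ∎
    where
    b′ = β (suc n)
    e = qpow (suc n * k)
    y = qpow (suc n)
  Ψ-first : Ψ 0 ≈ x
  Ψ-first = ≈-trans (⊛-cong (≈-trans (⊛-identityˡ (inv one)) inv-one) (qpow-cong (ℕP.+-identityʳ (suc k)))) (⊛-identityˡ x)
  Ψ-rest : ∀ n → Ψ (suc n) ≈ x ⊛ φTerm (suc k) n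
  Ψ-rest n = ≈-trans (⊛-cong (≈-refl {β (suc n)}) (qpow-+ (suc k) (suc n * suc k)))
             (solve 3 (λ b x e → b :* (x :* e) := x :* (b :* e)) ≈-refl (β (suc n)) x (qpow (suc n * suc k)))
  consecutive-sum : φSeries k ⊕ φSeries (suc k) ≈ x ⊕ x ⊛ φSeries (suc k)
  consecutive-sum = begin
    φSeries k ⊕ φSeries (suc k)            ≈⟨ Σ∞-⊕ (φTerm k) (φTerm (suc k)) ⟨
    Σ∞ (λ n → φTerm k n ⊕ φTerm (suc k) n) ≈⟨ Σ∞-cong pair ⟩
    Σ∞ Ψ                                   ≈⟨ Σ∞-first Ψ Ψ-summable ⟩
    Ψ 0 ⊕ Σ∞ (λ n → Ψ (suc n))             ≈⟨ ⊕-cong Ψ-first (Σ∞-cong Ψ-rest) ⟩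
    x ⊕ Σ∞ (λ n → x ⊛ φTerm (suc k) n)     ≈⟨ ⊕-cong (≈-refl {x}) (⊛-distribˡ-Σ∞ x (φTerm (suc k)) (Summable-φTerm (suc k))) ⟨
    x ⊕ x ⊛ φSeries (suc k)                ∎

φSeries≈aSeries : ∀ k → φSeries k ≈ aSeries k
φSeries≈aSeries k N = ℤP.i-j≡0⇒i≡j (φSeries k N) (aSeries k N) (difference≈0 k N)
  where
  difference≈0 : ∀ k → φSeries k ⊖ aSeries k ≈ zeroPS
  difference≈0 = recurrence-vanishing (λ k → φSeries k ⊖ aSeries k) (λ k → negPS (one ⊖ qpow (suc k)))
    (λ k → ≈-trans (⊖-cong (φSeries-rec k) (aSeries-rec k))
      (solve 4 (λ x u f g → (x :+ :- (u :* f)) :- (x :+ :- (u :* g)) := (:- u) :* (f :- g))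
         ≈-refl (qpow (suc k)) (one ⊖ qpow (suc k)) (φSeries (suc k)) (aSeries (suc k))))
    (λ k → q^∣-⊖ (q^∣-φSeries k) (q^∣-aSeries k))

lhsReduced : ℕ → PS
lhsReduced k = mono (sgn k) (suc k) ⊛ qq k ⊛ inv (mqq (suc k))

rhsReduced : ℕ → PS
rhsReduced n = β (suc n) ⊛ inv (one ⊕ qpow (suc n))

Summable-lhsReduced : Summable lhsReduced
Summable-lhsReduced k = q^∣-weaken (ℕP.n≤1+n k)
  (q^∣-⊛ˡ (inv (mqq (suc k))) (q^∣-⊛ˡ (qq k) (q^∣-mono (sgn k) (suc k))))

Summable-rhsReduced : Summable rhsReduced
Summable-rhsReduced n = q^∣-weaken (n≤triangular[1+n] n)
  (q^∣-⊛ˡ (inv (one ⊕ qpow (suc n))) (q^∣-⊛ˡ (inv (mqq (suc n))) (q^∣-mono 1ℤ (triangular (suc n)))))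

altSum-aSeries : PS
altSum-aSeries = Σ∞ (λ k → mono (sgn k) 0 ⊛ aSeries k)

Σ∞-rhsReduced : Σ∞ rhsReduced ≈ altSum-aSeries
Σ∞-rhsReduced = begin
  Σ∞ rhsReduced
    ≈⟨ Σ∞-cong (λ n → ≈-trans (⊛-cong (≈-refl {β (suc n)}) (inv-one⊕qpow n))
                              (⊛-distribˡ-Σ∞ (β (suc n)) (altGeom (suc n)) (Summable-altGeom n))) ⟩
  Σ∞ (λ n → Σ∞ (λ k → β (suc n) ⊛ altGeom (suc n) k))
    ≈⟨ Σ∞-swap (λ n k → β (suc n) ⊛ altGeom (suc n) k) ⟩
  Σ∞ (λ k → Σ∞ (λ n → β (suc n) ⊛ altGeom (suc n) k))
    ≈⟨ Σ∞-cong (λ k → Σ∞-cong (λ n → term n k)) ⟩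
  Σ∞ (λ k → Σ∞ (λ n → mono (sgn k) 0 ⊛ φTerm k n))
    ≈⟨ Σ∞-cong (λ k → ≈-trans (≈-sym (⊛-distribˡ-Σ∞ (mono (sgn k) 0) (φTerm k) (Summable-φTerm k)))
                              (⊛-cong (≈-refl {mono (sgn k) 0}) (φSeries≈aSeries k))) ⟩
  altSum-aSeries
    ∎
  where
  open ≈-Reasoning
  term : ∀ n k → β (suc n) ⊛ altGeom (suc n) k ≈ mono (sgn k) 0 ⊛ φTerm k n
  term n k = ≈-trans (⊛-cong (≈-refl {β (suc n)}) (mono≈const⊛qpow (sgn k) (suc n * k)))
    (solve 3 (λ b m e → b :* (m :* e) := m :* (b :* e)) ≈-refl (β (suc n)) (mono (sgn k) 0) (qpow (suc n * k)))

Σ∞-lhsReduced : Σ∞ lhsReduced ≈ altSum-aSeries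
Σ∞-lhsReduced = begin
  Σ∞ lhsReduced
    ≈⟨ Σ∞-cong (λ s → ≈-trans (⊛-cong (≈-refl {W s}) (inv-mqq (suc s)))
                              (⊛-distribˡ-Σ∞ (W s) (recipTerm (suc s)) (Summable-recipTerm (suc s)))) ⟩
  Σ∞ (λ s → Σ∞ (λ i → W s ⊛ recipTerm (suc s) i))
    ≈⟨ Σ∞-swap (λ s i → W s ⊛ recipTerm (suc s) i) ⟩
  Σ∞ (λ i → Σ∞ (λ s → W s ⊛ recipTerm (suc s) i))
    ≈⟨ Σ∞-cong (λ i → Σ∞-cong (λ s → term s i)) ⟩
  Σ∞ (λ i → Σ∞ (λ s → mono (sgn i) 0 ⊛ aTerm i s))
    ≈⟨ Σ∞-cong (λ i → ≈-sym (⊛-distribˡ-Σ∞ (mono (sgn i) 0) (aTerm i) (Summable-aTerm i))) ⟩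
  altSum-aSeries
    ∎
  where
  open ≈-Reasoning
  W : ℕ → PS
  W s = mono (sgn s) (suc s) ⊛ qq s
  signs : ∀ s i → mono (sgn s) (suc s) ⊛ mono (sgn i) i ≈ mono (sgn i) 0 ⊛ mono (sgn s) (suc i + s)
  signs s i = ≈-trans (mono-⊛-mono (sgn s) (sgn i) (suc s) i) (≈-sym (≈-trans (mono-⊛-mono (sgn i) (sgn s) 0 (suc i + s))
    (λ N → cong₂ (λ c e → mono c e N) (ℤP.*-comm (sgn i) (sgn s)) (cong suc (ℕP.+-comm i s)))))
  pochs : ∀ s i → qq s ⊛ poch⁺ (suc s) i ≈ qq i ⊛ poch⁺ (suc i) s
  pochs s i = ≈-trans (≈-sym (poch-mono-split 1ℤ 1 s i))
    (≈-trans (λ N → cong (λ m → qq m N) (ℕP.+-comm s i)) (poch-mono-split 1ℤ 1 i s))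
  term : ∀ s i → W s ⊛ recipTerm (suc s) i ≈ mono (sgn i) 0 ⊛ aTerm i s
  term s i = begin
    (mₛ ⊛ qq s) ⊛ ((mᵢ ⊛ poch⁺ (suc s) i) ⊛ inv (qq i))
      ≈⟨ solve 5 (λ ms as mi aq ia → (ms :* as) :* ((mi :* aq) :* ia) := (ms :* mi) :* (as :* aq) :* ia)
           ≈-refl mₛ (qq s) mᵢ (poch⁺ (suc s) i) (inv (qq i)) ⟩
    (mₛ ⊛ mᵢ) ⊛ (qq s ⊛ poch⁺ (suc s) i) ⊛ inv (qq i)
      ≈⟨ ⊛-cong (⊛-cong (signs s i) (pochs s i)) (≈-refl {inv (qq i)}) ⟩
    (m₀ ⊛ m) ⊛ (qq i ⊛ poch⁺ (suc i) s) ⊛ inv (qq i)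
      ≈⟨ solve 5 (λ m0 m ai aq ia → (m0 :* m) :* (ai :* aq) :* ia := (m0 :* (m :* aq)) :* (ai :* ia))
           ≈-refl m₀ m (qq i) (poch⁺ (suc i) s) (inv (qq i)) ⟩
    (m₀ ⊛ aTerm i s) ⊛ (qq i ⊛ inv (qq i))
      ≈⟨ ⊛-cong (≈-refl {m₀ ⊛ aTerm i s}) (inv-inverseʳ (qq i) (ConstTermOne-qq i)) ⟩
    (m₀ ⊛ aTerm i s) ⊛ one
      ≈⟨ ⊛-identityʳ (m₀ ⊛ aTerm i s) ⟩
    m₀ ⊛ aTerm i s
      ∎
    where
    mₛ = mono (sgn s) (suc s)
    mᵢ = mono (sgn i) i
    m₀ = mono (sgn i) 0
    m = mono (sgn s) (suc i + s)

two : PS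
two = mono (+ 2) 0

lhs-value : Σ∞ (λ i → lhsTerm (suc i)) ≈ (two ⊛ ρ) ⊛ Σ∞ lhsReduced
lhs-value = begin
  Σ∞ (λ i → lhsTerm (suc i))
    ≈⟨ Σ∞-cong expand ⟩
  Σ∞ (λ i → Σ∞ (λ k → F i k))
    ≈⟨ Σ∞-swap F ⟩
  Σ∞ (λ k → Σ∞ (λ i → F i k))
    ≈⟨ Σ∞-cong (λ k → Σ∞-cong (λ i → regroup i k)) ⟩
  Σ∞ (λ k → Σ∞ (λ i → c k ⊛ qbinTerm (suc k) i))
    ≈⟨ Σ∞-cong (λ k → ≈-trans (≈-sym (⊛-distribˡ-Σ∞ (c k) (qbinTerm (suc k)) (Summable-qbinTerm k)))
                              (⊛-cong (≈-refl {c k}) (qbin-closed-form k))) ⟩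
  Σ∞ (λ k → c k ⊛ (ρ ⊛ qq k ⊛ inv (mqq (suc k))))
    ≈⟨ Σ∞-cong factor-2ρ ⟩
  Σ∞ (λ k → (two ⊛ ρ) ⊛ lhsReduced k)
    ≈⟨ ⊛-distribˡ-Σ∞ (two ⊛ ρ) lhsReduced Summable-lhsReduced ⟨
  (two ⊛ ρ) ⊛ Σ∞ lhsReduced
    ∎
  where
  open ≈-Reasoning
  c : ℕ → PS
  c k = mono (+ 2 ℤ.* sgn k) (suc k)
  F : ℕ → ℕ → PS
  F i k = (mono (+ 2) (suc i) ⊛ altGeom (suc i) k) ⊛ mqq/qq i
  expand : ∀ i → lhsTerm (suc i) ≈ Σ∞ (F i)
  expand i = begin
    ((mono (+ 2) (suc i) ⊛ inv (one ⊕ qpow (suc i))) ⊛ mqq i) ⊛ inv (qq i)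
      ≈⟨ ⊛-assoc (mono (+ 2) (suc i) ⊛ inv (one ⊕ qpow (suc i))) (mqq i) (inv (qq i)) ⟩
    (mono (+ 2) (suc i) ⊛ inv (one ⊕ qpow (suc i))) ⊛ mqq/qq i
      ≈⟨ ⊛-cong (≈-trans (⊛-cong (≈-refl {mono (+ 2) (suc i)}) (inv-one⊕qpow i))
                         (⊛-distribˡ-Σ∞ (mono (+ 2) (suc i)) (altGeom (suc i)) (Summable-altGeom i)))
                (≈-refl {mqq/qq i}) ⟩
    Σ∞ (λ k → mono (+ 2) (suc i) ⊛ altGeom (suc i) k) ⊛ mqq/qq i
      ≈⟨ ⊛-distribʳ-Σ∞ (mqq/qq i) _ (Summable-⊛ (mono (+ 2) (suc i)) (Summable-altGeom i)) ⟩
    Σ∞ (F i)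
      ∎
  exponents : ∀ i k → suc i + suc i * k ≡ suc k + suc k * i
  exponents = solve-∀
  regroup : ∀ i k → F i k ≈ c k ⊛ qbinTerm (suc k) i
  regroup i k = begin
    (mono (+ 2) (suc i) ⊛ altGeom (suc i) k) ⊛ mqq/qq i
      ≈⟨ ⊛-cong (mono-⊛-mono (+ 2) (sgn k) (suc i) (suc i * k)) (≈-refl {mqq/qq i}) ⟩
    mono (+ 2 ℤ.* sgn k) (suc i + suc i * k) ⊛ mqq/qq i
      ≈⟨ ⊛-cong (λ N → cong₂ (λ a e → mono a e N) (sym (ℤP.*-identityʳ (+ 2 ℤ.* sgn k))) (exponents i k)) (≈-refl {mqq/qq i}) ⟩
    mono (+ 2 ℤ.* sgn k ℤ.* 1ℤ) (suc k + suc k * i) ⊛ mqq/qq i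
      ≈⟨ ⊛-cong (≈-sym (mono-⊛-mono (+ 2 ℤ.* sgn k) 1ℤ (suc k) (suc k * i))) (≈-refl {mqq/qq i}) ⟩
    (c k ⊛ qpow (suc k * i)) ⊛ mqq/qq i
      ≈⟨ solve 3 (λ m e r → (m :* e) :* r := m :* (r :* e)) ≈-refl (c k) (qpow (suc k * i)) (mqq/qq i) ⟩
    c k ⊛ qbinTerm (suc k) i
      ∎
  factor-2ρ : ∀ k → c k ⊛ (ρ ⊛ qq k ⊛ inv (mqq (suc k))) ≈ (two ⊛ ρ) ⊛ lhsReduced k
  factor-2ρ k = ≈-trans (⊛-cong (≈-sym (mono-⊛-mono (+ 2) (sgn k) 0 (suc k))) (≈-refl {ρ ⊛ qq k ⊛ inv (mqq (suc k))}))
    (solve 5 (λ t m r a b → (t :* m) :* (r :* a :* b) := (t :* r) :* (m :* a :* b))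
       ≈-refl two (mono (sgn k) (suc k)) ρ (qq k) (inv (mqq (suc k))))

inv-one⊖qpow-double : ∀ n → inv (one ⊖ qpow (2 * suc n)) ⊛ (one ⊖ qpow (suc n)) ≈ inv (one ⊕ qpow (suc n))
inv-one⊖qpow-double n = begin
  inv (one ⊖ qpow (2 * suc n)) ⊛ U ≈⟨ ⊛-cong (inv-cong difference-of-squares) (≈-refl {U}) ⟩
  inv (U ⊛ P) ⊛ U                  ≈⟨ ⊛-cong (inv-⊛ U P (ConstTermOne-one⊖qpow n) (ConstTermOne-one⊕qpow n)) (≈-refl {U}) ⟩
  (inv U ⊛ inv P) ⊛ U              ≈⟨ solve 3 (λ iu ip u → (iu :* ip) :* u := ip :* (iu :* u)) ≈-refl (inv U) (inv P) U ⟩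
  inv P ⊛ (inv U ⊛ U)              ≈⟨ ⊛-cong (≈-refl {inv P}) (inv-inverseˡ U (ConstTermOne-one⊖qpow n)) ⟩
  inv P ⊛ one                      ≈⟨ ⊛-identityʳ (inv P) ⟩
  inv P                            ∎
  where
  open ≈-Reasoning
  x = qpow (suc n)
  U = one ⊖ x
  P = one ⊕ x
  difference-of-squares : one ⊖ qpow (2 * suc n) ≈ U ⊛ P
  difference-of-squares = ≈-trans
    (⊖-cong (≈-refl {one}) (≈-trans (qpow-+ (suc n) (suc n + 0)) (⊛-cong (≈-refl {x}) (qpow-cong (ℕP.+-identityʳ (suc n))))))
    (solve 1 (λ x → con 1ℤ :- x :* x := (con 1ℤ :- x) :* (con 1ℤ :+ x)) ≈-refl x)

rhsTerm-reduced : ∀ P Q → (∀ n → Converges (poch (negqpow (n + 2))) (P n)) →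
                  (∀ n → Converges (poch (qpow (n + 2))) (Q n)) →
                  ∀ n → rhsTerm P Q n ≈ (two ⊛ ρ) ⊛ rhsReduced n
rhsTerm-reduced P Q P-limit Q-limit n = begin
  (((qT′ ⊛ iA) ⊛ (m2 ⊛ iD)) ⊛ P n) ⊛ inv (Q n)
    ≈⟨ ⊛-assoc ((qT′ ⊛ iA) ⊛ (m2 ⊛ iD)) (P n) (inv (Q n)) ⟩
  ((qT′ ⊛ iA) ⊛ (m2 ⊛ iD)) ⊛ (P n ⊛ inv (Q n))
    ≈⟨ ⊛-cong (⊛-cong (⊛-cong (qpow-cong (n[1+n]/2≡triangular n)) (≈-refl {iA})) (⊛-cong (mono≈const⊛qpow (+ 2) (suc n)) (≈-refl {iD})))
              (≈-trans P/Q (⊛-cong (⊛-cong (≈-refl {ρ}) (poch⁺-snoc 1 n)) (≈-refl {iB}))) ⟩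
  ((t ⊛ iA) ⊛ ((two ⊛ x) ⊛ iD)) ⊛ (ρ ⊛ (qq n ⊛ U) ⊛ iB)
    ≈⟨ solve 9 (λ t ia tw x j r a u ib → ((t :* ia) :* ((tw :* x) :* j)) :* (r :* (a :* u) :* ib)
                := (tw :* r) :* ((t :* x) :* ib :* (j :* u)) :* (ia :* a)) ≈-refl t iA two x iD ρ (qq n) U iB ⟩
  (two ⊛ ρ) ⊛ ((t ⊛ x) ⊛ iB ⊛ (iD ⊛ U)) ⊛ (iA ⊛ qq n)
    ≈⟨ ⊛-cong (⊛-cong (≈-refl {two ⊛ ρ}) (⊛-cong (⊛-cong (≈-sym (qpow-+ (triangular n) (suc n))) (≈-refl {iB})) (inv-one⊖qpow-double n)))
              (inv-inverseˡ (qq n) (ConstTermOne-qq n)) ⟩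
  (two ⊛ ρ) ⊛ rhsReduced n ⊛ one
    ≈⟨ ⊛-identityʳ ((two ⊛ ρ) ⊛ rhsReduced n) ⟩
  (two ⊛ ρ) ⊛ rhsReduced n
    ∎
  where
  open ≈-Reasoning
  qT′ = qpow ((n * suc n) ℕ./ 2)
  t = qpow (triangular n)
  iA = inv (qq n)
  m2 = mono (+ 2) (suc n)
  iD = inv (one ⊖ qpow (2 * suc n))
  x = qpow (suc n)
  U = one ⊖ x
  iB = inv (mqq (suc n))
  n+2≡2+n = ℕP.+-comm n 2
  P/Q : P n ⊛ inv (Q n) ≈ ρ ⊛ qq (suc n) ⊛ inv (mqq (suc n))
  P/Q = infinite-poch-ratio (suc n)
          (subst (λ m → Converges (poch (negqpow m)) (P n)) n+2≡2+n (P-limit n))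
          (subst (λ m → Converges (poch (qpow m)) (Q n)) n+2≡2+n (Q-limit n))

Summable-lhsTerm : Summable (λ i → lhsTerm (suc i))
Summable-lhsTerm i = q^∣-weaken (ℕP.n≤1+n i)
  (q^∣-⊛ˡ (inv (qq i)) (q^∣-⊛ˡ (mqq i) (q^∣-⊛ˡ (inv (one ⊕ qpow (suc i))) (q^∣-mono (+ 2) (suc i)))))

theorem3p3 : (P Q : ℕ → PS)
    → (∀ n → Converges (poch (negqpow (n + 2))) (P n))
    → (∀ n → Converges (poch (qpow (n + 2))) (Q n))
    → ∃ λ T → Converges lhsPartial T × Converges (rhsPartial P Q) T
theorem3p3 P Q P-limit Q-limit =
  (two ⊛ ρ) ⊛ Σ∞ rhsReduced ,
  Converges-≈ (partial-sums-converge _ Summable-lhsTerm) lhs≈ ,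
  Converges-≈ (partial-sums-converge (rhsTerm P Q) rhs-summable) rhs≈
  where
  rhsTerm≈ : ∀ n → rhsTerm P Q n ≈ (two ⊛ ρ) ⊛ rhsReduced n
  rhsTerm≈ = rhsTerm-reduced P Q P-limit Q-limit
  rhs-summable : Summable (rhsTerm P Q)
  rhs-summable = Summable-≈ (λ n → ≈-sym (rhsTerm≈ n)) (Summable-⊛ (two ⊛ ρ) Summable-rhsReduced)
  lhs≈ : Σ∞ (λ i → lhsTerm (suc i)) ≈ (two ⊛ ρ) ⊛ Σ∞ rhsReduced
  lhs≈ = ≈-trans lhs-value (⊛-cong (≈-refl {two ⊛ ρ}) (≈-trans Σ∞-lhsReduced (≈-sym Σ∞-rhsReduced)))
  rhs≈ : Σ∞ (rhsTerm P Q) ≈ (two ⊛ ρ) ⊛ Σ∞ rhsReduced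
  rhs≈ = ≈-trans (Σ∞-cong rhsTerm≈) (≈-sym (⊛-distribˡ-Σ∞ (two ⊛ ρ) rhsReduced Summable-rhsReduced))
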